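{- Let $S$ be a finite Kleene relation algebra satisfying the Tarski rule, let $p_0 \in S$ be a forest and let $x \in S$ be a point. Consider the program with program variables $p, t, y$ ranging over $S$, started with $p = p_0$: $y := x$; while $y \neq p^T\cdot y$ do $t := p^T\cdot y$; $p := \big(y \sqcap (p^T\cdot p^T\cdot y)^T\big)\sqcup(\overline{y}\sqcap p)$; $y := t$ od. Then the program terminates, and in its final state: $p$ is a forest; $y$ is a point; $y = ((p^T)^*\cdot x)\sqcap((p\sqcap 1)\cdot\top)$; $p^*\cdot(p^T)^* = p_0^*\cdot(p_0^T)^*$; $p\sqcap 1 = p_0\sqcap 1$; and $p = (v \sqcap (p_0\cdot p_0)) \sqcup (\overline{v}\sqcap p_0)$ where $v = (p_0^T)^*\cdot x$.
   Context: A Kleene relation algebra is a structure $(S,\sqcup,\sqcap,\cdot,\overline{\phantom{x}},{}^T,{}^*,\bot,\top,1)$ such that $(S,\sqcup,\sqcap,\overline{\phantom{x}},\bot,\top)$ is a Boolean algebra with order $x \sqsubseteq y \iff x \sqcup y = y$; $(S,\sqcup,\cdot,\bot,1)$ is an idempotent semiring ($\cdot$ associative with two-sided unit $1$, distributing over $\sqcup$, $\bot$ a two-sided zero of $\cdot$); transposition satisfies $(x\sqcup y)^T = x^T \sqcup y^T$, $(x^T)^T = x$, $(x\cdot y)^T = y^T\cdot x^T$ and $(x\cdot y)\sqcap z \sqsubseteq x\cdot(y\sqcap(x^T\cdot z))$; and the star satisfies $1\sqcup y\cdot y^* = y^* = 1 \sqcup y^*\cdot y$, $z\sqcup y\cdot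 x\sqsubseteq x \Rightarrow y^*\cdot z\sqsubseteq x$, $z \sqcup x\cdot y \sqsubseteq x \Rightarrow z\cdot y^*\sqsubseteq x$. The Tarski rule states $\top\cdot x\cdot\top = \top$ for every $x \neq \bot$. Write $x^+ = x\cdot x^*$. An element $x$ is univalent if $x^T x\sqsubseteq 1$, total if $1\sqsubseteq x x^T$, a mapping if univalent and total, injective if $x x^T\sqsubseteq 1$, surjective if $1\sqsubseteq x^T x$, a vector if $x\cdot\top = x$, a point if it is an injective surjective vector, acyclic if $x^+\sqsubseteq\overline 1$, and a forest if it is a mapping and $x\sqcap\overline{1}$ is acyclic. Programs are sequential while-programs with the usual semantics; $p^T\cdot y$ reads the parent of node $y$, and the assignment to $p$ sets the parent of $y$ to its grandparent. The final equation says $p$ is the array update of $p_0$ at all nodes in $v$ to the value $(p_0\cdot p_0)^T$, i.e. $(v\sqcap ((p_0 p_0)^T)^T)\sqcup(\overline v \sqcap p_0)$. -}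

module Defs where

open import Level using (0ℓ)
open import Data.Nat using (ℕ)
open import Data.Fin using (Fin)
open import Data.Product using (Σ; _×_; _,_)
open import Function.Bundles using (_↔_)
open import Relation.Binary.PropositionalEquality using (_≡_)
open import Relation.Nullary using (¬_)
open import Algebra.Core using (Op₁; Op₂)
import Algebra.Structures as AS
import Algebra.Lattice.Structures as LS

record KleeneRelationAlgebra : Set₁ where
  infixl 7 _·_
  infixl 6 _⊓_
  infixl 5 _⊔_
  field
    S    : Set
    _⊔_  : Op₂ S
    _⊓_  : Op₂ S
    _·_  : Op₂ S
    ∁    : Op₁ S
    _ᵀ   : Op₁ S
    _*   : Op₁ S
    ⊥ ⊤ 𝟏 : S

  _⊑_ : S → S → Set
  x ⊑ y = x ⊔ y ≡ y

  field
    isBooleanAlgebra : LS.IsBooleanAlgebra (_≡_ {A = S}) _⊔_ _⊓_ ∁ ⊤ ⊥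
    isSemiring       : AS.IsSemiring (_≡_ {A = S}) _⊔_ _·_ ⊥ 𝟏
    ⊔-idem           : ∀ x → x ⊔ x ≡ x
    ᵀ-⊔   : ∀ x y → (x ⊔ y) ᵀ ≡ (x ᵀ) ⊔ (y ᵀ)
    ᵀ-inv : ∀ x → (x ᵀ) ᵀ ≡ x
    ᵀ-·   : ∀ x y → (x · y) ᵀ ≡ (y ᵀ) · (x ᵀ)
    dedekind : ∀ x y z → (x · y) ⊓ z ⊑ x · (y ⊓ ((x ᵀ) · z))
    star-unfoldˡ : ∀ y → 𝟏 ⊔ y · (y *) ≡ y *
    star-unfoldʳ : ∀ y → 𝟏 ⊔ (y *) · y ≡ y *
    star-inductˡ : ∀ x y z → (z ⊔ y · x) ⊑ x → (y *) · z ⊑ x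
    star-inductʳ : ∀ x y z → (z ⊔ x · y) ⊑ x → z · (y *) ⊑ x

  infix 4 _⊑_

  _⁺ : S → S
  x ⁺ = x · (x *)

  Tarski : Set
  Tarski = ∀ x → ¬ (x ≡ ⊥) → ⊤ · x · ⊤ ≡ ⊤

  Finite : Set
  Finite = Σ ℕ λ n → S ↔ Fin n

  univalent total mapping injective surjective vector point acyclic forest : S → Set
  univalent x  = (x ᵀ) · x ⊑ 𝟏
  total x      = 𝟏 ⊑ x · (x ᵀ)
  mapping x    = univalent x × total x
  injective x  = x · (x ᵀ) ⊑ 𝟏
  surjective x = 𝟏 ⊑ (x ᵀ) · x
  vector x     = x · ⊤ ≡ x
  point x      = injective x × surjective x × vector x
  acyclic x    = x ⁺ ⊑ ∁ 𝟏
  forest x     = mapping x × acyclic (x ⊓ ∁ 𝟏)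

  record State : Set where
    eta-equality
    constructor ⟨_,_,_⟩
    field
      p t y : S
  open State public

  body : State → State
  body s =
    let t′ = (p s ᵀ) · y s
        p′ = (y s ⊓ ((p s ᵀ) · (p s ᵀ) · y s) ᵀ) ⊔ (∁ (y s) ⊓ p s)
    in ⟨ p′ , t′ , t′ ⟩

  -- Big-step semantics of:  while y ≠ pᵀ·y do body od
  data Loop : State → State → Set where
    loop-exit : ∀ {s} → y s ≡ (p s ᵀ) · y s → Loop s s
    loop-step : ∀ {s s′} → ¬ (y s ≡ (p s ᵀ) · y s) → Loop (body s) s′ → Loop s s′

  Exec : S → State → State → Set
  Exec x s s′ = Loop ⟨ p s , t s , x ⟩ s′

  Post : S → S → State → Set
  Post p₀ x s =
    forest (p s) ×
    point (y s) ×
    y s ≡ (((p s ᵀ) *) · x) ⊓ ((p s ⊓ 𝟏) · ⊤) ×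
    ((p s) *) · ((p s ᵀ) *) ≡ (p₀ *) · ((p₀ ᵀ) *) ×
    p s ⊓ 𝟏 ≡ p₀ ⊓ 𝟏 ×
    p s ≡ (v ⊓ (p₀ · p₀)) ⊔ (∁ v ⊓ p₀)
    where v = ((p₀ ᵀ) *) · x

{-# OPTIONS --safe #-}
-- Let v = (p₀ᵀ)* x be the path from x to its root. The loop keeps y a point on v and p equal to
-- p₀ updated to the grandparent p₀ p₀ exactly on the nodes of v strictly below y. These nodes
-- avoid y and all its ancestors, so p and p₀ give y the same parent and grandparent; hence an
-- iteration moves y one step up and adds the old y to the updated set, acyclicity and the Tarski
-- rule ensuring that a non-root y is not an ancestor of its own parent. The updated set thus grows
-- strictly in a finite lattice, so the loop terminates, with y the root and p = P the update of p₀
-- on all of v. The remaining postconditions hold because on v the relation P jumps two steps of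
-- p₀ towards the root, so P* y still reaches the whole path.
module Submission where

open import Level using (0ℓ)
open import Data.Fin as Fin using (Fin)
open import Data.Fin.Induction using (po-noetherian)
open import Data.Nat using (ℕ)
open import Data.Product using (Σ; _×_; _,_; proj₁; proj₂; map₂)
open import Function using (flip)
open import Function.Bundles using (_↔_; Inverse)
open import Function.Properties.Inverse using (↔⇒↣)
open import Induction.WellFounded using (WellFounded; Acc; acc; module Subrelation)
open import Algebra.Lattice.Bundles using (BooleanAlgebra)
import Algebra.Lattice.Properties.BooleanAlgebra as BooleanAlgebraProperties
open import Algebra.Structures using (IsSemiring)
open import Relation.Binary using (Rel; IsPartialOrder; Poset; DecidableEquality)
import Relation.Binary.Construct.NonStrictToStrict as ToStrict
import Relation.Binary.Construct.On as On
open import Relation.Binary.PropositionalEquality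
  using (_≡_; refl; sym; trans; cong; cong₂; subst; subst₂; isEquivalence; module ≡-Reasoning)
import Relation.Binary.Reasoning.PartialOrder as PosetReasoning
open import Relation.Nullary using (¬_; yes; no; contradiction)
open import Relation.Nullary.Decidable using (via-injection)

open import Defs

module _ {A : Set} {n : ℕ} (A↔Fin : A ↔ Fin n) where
  open Inverse A↔Fin

  finite⇒≟ : DecidableEquality A
  finite⇒≟ = via-injection (↔⇒↣ A↔Fin) Fin._≟_

  finite⇒noetherian : ∀ {ℓ} {_≤_ : Rel A ℓ} → IsPartialOrder _≡_ _≤_ →
                      WellFounded (flip (ToStrict._<_ _≡_ _≤_))
  finite⇒noetherian {_≤_ = _≤_} po =
    Subrelation.wellFounded pull (On.wellFounded to (po-noetherian (On.isPartialOrder from po)))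
    where
    pull : ∀ {a b} → b ≤ a × ¬ b ≡ a → from (to b) ≤ from (to a) × ¬ from (to b) ≡ from (to a)
    pull {a} {b} (b≤a , b≢a) =
      subst₂ _≤_ (sym (strictlyInverseʳ b)) (sym (strictlyInverseʳ a)) b≤a ,
      λ e → b≢a (trans (sym (strictlyInverseʳ b)) (trans e (strictlyInverseʳ a)))

module Order (K : KleeneRelationAlgebra) where
  open KleeneRelationAlgebra K public hiding (p; t; y)

  booleanAlgebra : BooleanAlgebra 0ℓ 0ℓ
  booleanAlgebra = record
    { Carrier = S ; _≈_ = _≡_ ; _∨_ = _⊔_ ; _∧_ = _⊓_ ; ¬_ = ∁ ; ⊤ = ⊤ ; ⊥ = ⊥
    ; isBooleanAlgebra = isBooleanAlgebra }

  open BooleanAlgebra booleanAlgebra public using () renaming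
    ( ∨-comm to ⊔-comm ; ∨-assoc to ⊔-assoc ; ∧-comm to ⊓-comm ; ∧-assoc to ⊓-assoc
    ; ∨-absorbs-∧ to ⊔-absorbs-⊓ ; ∧-absorbs-∨ to ⊓-absorbs-⊔
    ; ∧-distribˡ-∨ to ⊓-distribˡ-⊔ ; ∧-distribʳ-∨ to ⊓-distribʳ-⊔ ; ∨-distribˡ-∧ to ⊔-distribˡ-⊓
    ; ∨-complementʳ to ⊔-complementʳ ; ∧-complementʳ to ⊓-complementʳ ; ∧-complementˡ to ⊓-complementˡ )
  open BooleanAlgebraProperties booleanAlgebra public using () renaming
    ( ∧-identityʳ to ⊓-identityʳ ; ∧-identityˡ to ⊓-identityˡ ; ∨-identityʳ to ⊔-identityʳ
    ; ∨-identityˡ to ⊔-identityˡ ; ∧-zeroˡ to ⊓-zeroˡ ; ∨-zeroʳ to ⊔-zeroʳ ; ∧-idem to ⊓-idem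
    ; deMorgan₂ to ∁-⊔ ; ¬-involutive to ∁-involutive ; ¬⊥≈⊤ to ∁⊥≡⊤ )
  open IsSemiring isSemiring public using () renaming
    ( *-assoc to ·-assoc ; *-identityˡ to ·-identityˡ ; *-identityʳ to ·-identityʳ
    ; distribˡ to ·-distribˡ-⊔ ; distribʳ to ·-distribʳ-⊔ ; zeroˡ to ·-zeroˡ ; zeroʳ to ·-zeroʳ )

  ⊑-refl : ∀ {x} → x ⊑ x
  ⊑-refl = ⊔-idem _

  ⊑-reflexive : ∀ {x y} → x ≡ y → x ⊑ y
  ⊑-reflexive refl = ⊑-refl

  ⊑-trans : ∀ {x y z} → x ⊑ y → y ⊑ z → x ⊑ z
  ⊑-trans {x} {y} {z} x⊑y y⊑z = begin
    x ⊔ z        ≡⟨ cong (x ⊔_) y⊑z ⟨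
    x ⊔ (y ⊔ z)  ≡⟨ ⊔-assoc x y z ⟨
    (x ⊔ y) ⊔ z  ≡⟨ cong (_⊔ z) x⊑y ⟩
    y ⊔ z        ≡⟨ y⊑z ⟩
    z            ∎
    where open ≡-Reasoning

  ⊑-antisym : ∀ {x y} → x ⊑ y → y ⊑ x → x ≡ y
  ⊑-antisym {x} {y} x⊑y y⊑x = trans (sym y⊑x) (trans (⊔-comm y x) x⊑y)

  ⊑-isPartialOrder : IsPartialOrder _≡_ _⊑_
  ⊑-isPartialOrder = record
    { isPreorder = record { isEquivalence = isEquivalence ; reflexive = ⊑-reflexive ; trans = ⊑-trans }
    ; antisym = ⊑-antisym }

  ⊑-poset : Poset 0ℓ 0ℓ 0ℓ
  ⊑-poset = record { isPartialOrder = ⊑-isPartialOrder }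

  module ⊑-Reasoning = PosetReasoning ⊑-poset

  _⊏_ : Rel S 0ℓ
  _⊏_ = ToStrict._<_ _≡_ _⊑_

  x⊑x⊔y : ∀ {x y} → x ⊑ x ⊔ y
  x⊑x⊔y {x} {y} = trans (sym (⊔-assoc x x y)) (cong (_⊔ y) (⊔-idem x))

  y⊑x⊔y : ∀ {x y} → y ⊑ x ⊔ y
  y⊑x⊔y {x} {y} = subst (y ⊑_) (⊔-comm y x) x⊑x⊔y

  ⊔-least : ∀ {x y z} → x ⊑ z → y ⊑ z → x ⊔ y ⊑ z
  ⊔-least {x} {y} {z} x⊑z y⊑z = trans (⊔-assoc x y z) (trans (cong (x ⊔_) y⊑z) x⊑z)

  ⊑⇒⊓≡ : ∀ {x y} → x ⊑ y → x ⊓ y ≡ x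
  ⊑⇒⊓≡ {x} {y} x⊑y = trans (cong (x ⊓_) (sym x⊑y)) (⊓-absorbs-⊔ x y)

  ⊓≡⇒⊑ : ∀ {x y} → x ⊓ y ≡ x → x ⊑ y
  ⊓≡⇒⊑ {x} {y} e = begin
    x ⊔ y        ≡⟨ cong (_⊔ y) e ⟨
    (x ⊓ y) ⊔ y  ≡⟨ ⊔-comm _ y ⟩
    y ⊔ (x ⊓ y)  ≡⟨ cong (y ⊔_) (⊓-comm x y) ⟩
    y ⊔ (y ⊓ x)  ≡⟨ ⊔-absorbs-⊓ y x ⟩
    y            ∎
    where open ≡-Reasoning

  x⊓y⊑x : ∀ {x y} → x ⊓ y ⊑ x
  x⊓y⊑x {x} {y} = ⊓≡⇒⊑ (trans (⊓-comm _ x) (trans (sym (⊓-assoc x x y)) (cong (_⊓ y) (⊓-idem x))))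

  x⊓y⊑y : ∀ {x y} → x ⊓ y ⊑ y
  x⊓y⊑y {x} {y} = subst (_⊑ y) (⊓-comm y x) x⊓y⊑x

  ⊓-greatest : ∀ {x y z} → z ⊑ x → z ⊑ y → z ⊑ x ⊓ y
  ⊓-greatest {x} {y} {z} z⊑x z⊑y =
    ⊓≡⇒⊑ (trans (sym (⊓-assoc z x y)) (trans (cong (_⊓ y) (⊑⇒⊓≡ z⊑x)) (⊑⇒⊓≡ z⊑y)))

  ⊔-mono : ∀ {a b c d} → a ⊑ b → c ⊑ d → a ⊔ c ⊑ b ⊔ d
  ⊔-mono a⊑b c⊑d = ⊔-least (⊑-trans a⊑b x⊑x⊔y) (⊑-trans c⊑d y⊑x⊔y)

  ⊓-mono : ∀ {a b c d} → a ⊑ b → c ⊑ d → a ⊓ c ⊑ b ⊓ d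
  ⊓-mono a⊑b c⊑d = ⊓-greatest (⊑-trans x⊓y⊑x a⊑b) (⊑-trans x⊓y⊑y c⊑d)

  ⊤-greatest : ∀ {x} → x ⊑ ⊤
  ⊤-greatest = ⊔-zeroʳ _

  x⊑⊥⇒x≡⊥ : ∀ {x} → x ⊑ ⊥ → x ≡ ⊥
  x⊑⊥⇒x≡⊥ {x} x⊑⊥ = trans (sym (⊔-identityʳ x)) x⊑⊥

  ⊓-∁-split : ∀ x y → x ≡ (x ⊓ y) ⊔ (x ⊓ ∁ y)
  ⊓-∁-split x y = begin
    x                        ≡⟨ ⊓-identityʳ x ⟨
    x ⊓ ⊤                    ≡⟨ cong (x ⊓_) (⊔-complementʳ y) ⟨
    x ⊓ (y ⊔ ∁ y)            ≡⟨ ⊓-distribˡ-⊔ x y (∁ y) ⟩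
    (x ⊓ y) ⊔ (x ⊓ ∁ y)      ∎
    where open ≡-Reasoning

  ⊓≡⊥⇒⊑∁ : ∀ {x y} → x ⊓ y ≡ ⊥ → x ⊑ ∁ y
  ⊓≡⊥⇒⊑∁ {x} {y} e = ⊓≡⇒⊑ (sym (trans (⊓-∁-split x y) (trans (cong (_⊔ (x ⊓ ∁ y)) e) (⊔-identityˡ _))))

  ⊑-⊑∁⇒≡⊥ : ∀ {x z} → x ⊑ z → x ⊑ ∁ z → x ≡ ⊥
  ⊑-⊑∁⇒≡⊥ {z = z} x⊑z x⊑∁z = x⊑⊥⇒x≡⊥ (⊑-trans (⊓-greatest x⊑z x⊑∁z) (⊑-reflexive (⊓-complementʳ z)))

  ⊑-⊑∁⇒⊓≡⊥ : ∀ {x y z} → x ⊑ z → y ⊑ ∁ z → x ⊓ y ≡ ⊥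
  ⊑-⊑∁⇒⊓≡⊥ x⊑z y⊑∁z = ⊑-⊑∁⇒≡⊥ (⊑-trans x⊓y⊑x x⊑z) (⊑-trans x⊓y⊑y y⊑∁z)

  ⊓⊑⇒⊑∁⊔ : ∀ {x y z} → x ⊓ y ⊑ z → x ⊑ ∁ y ⊔ z
  ⊓⊑⇒⊑∁⊔ {x} {y} {z} x⊓y⊑z =
    subst (_⊑ ∁ y ⊔ z) (sym (⊓-∁-split x y)) (⊔-least (⊑-trans x⊓y⊑z y⊑x⊔y) (⊑-trans x⊓y⊑y x⊑x⊔y))

  ⊑∁⊔⇒⊓⊑ : ∀ {x y z} → x ⊑ ∁ y ⊔ z → x ⊓ y ⊑ z
  ⊑∁⊔⇒⊓⊑ {x} {y} {z} x⊑∁y⊔z = begin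
    x ⊓ y                    ≤⟨ ⊓-mono x⊑∁y⊔z ⊑-refl ⟩
    (∁ y ⊔ z) ⊓ y            ≡⟨ ⊓-distribʳ-⊔ y (∁ y) z ⟩
    (∁ y ⊓ y) ⊔ (z ⊓ y)      ≡⟨ cong (_⊔ (z ⊓ y)) (⊓-complementˡ y) ⟩
    ⊥ ⊔ (z ⊓ y)              ≡⟨ ⊔-identityˡ _ ⟩
    z ⊓ y                    ≤⟨ x⊓y⊑x ⟩
    z                        ∎
    where open ⊑-Reasoning

module RelationAlgebra (K : KleeneRelationAlgebra) where
  open Order K public
  open ⊑-Reasoning

  ·-monoʳ : ∀ {x y} z → x ⊑ y → z · x ⊑ z · y
  ·-monoʳ {x} {y} z x⊑y = trans (sym (·-distribˡ-⊔ z x y)) (cong (z ·_) x⊑y)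

  ·-monoˡ : ∀ {x y} z → x ⊑ y → x · z ⊑ y · z
  ·-monoˡ {x} {y} z x⊑y = trans (sym (·-distribʳ-⊔ z x y)) (cong (_· z) x⊑y)

  ·-mono : ∀ {a b c d} → a ⊑ b → c ⊑ d → a · c ⊑ b · d
  ·-mono {b = b} {c} a⊑b c⊑d = ⊑-trans (·-monoˡ c a⊑b) (·-monoʳ b c⊑d)

  ·-assoc-inner : ∀ a b c d → a · b · (c · d) ≡ a · (b · c · d)
  ·-assoc-inner a b c d = trans (·-assoc a b (c · d)) (cong (a ·_) (sym (·-assoc b c d)))

  ·-assoc-middle : ∀ a b c d → a · (b · c) · d ≡ a · b · (c · d)
  ·-assoc-middle a b c d = trans (cong (_· d) (sym (·-assoc a b c))) (·-assoc (a · b) c d)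

  x⊑x·⊤ : ∀ {x} → x ⊑ x · ⊤
  x⊑x·⊤ {x} = subst (_⊑ x · ⊤) (·-identityʳ x) (·-monoʳ x ⊤-greatest)

  ⊤·⊤ : ⊤ · ⊤ ≡ ⊤
  ⊤·⊤ = ⊑-antisym ⊤-greatest x⊑x·⊤

  ᵀ-mono : ∀ {x y} → x ⊑ y → x ᵀ ⊑ y ᵀ
  ᵀ-mono {x} {y} x⊑y = trans (sym (ᵀ-⊔ x y)) (cong _ᵀ x⊑y)

  ⊑ᵀ⇒ᵀ⊑ : ∀ {x y} → x ⊑ y ᵀ → x ᵀ ⊑ y
  ⊑ᵀ⇒ᵀ⊑ {x} {y} x⊑yᵀ = subst (x ᵀ ⊑_) (ᵀ-inv y) (ᵀ-mono x⊑yᵀ)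

  ᵀ⊑⇒⊑ᵀ : ∀ {x y} → x ᵀ ⊑ y → x ⊑ y ᵀ
  ᵀ⊑⇒⊑ᵀ {x} {y} xᵀ⊑y = subst (_⊑ y ᵀ) (ᵀ-inv x) (ᵀ-mono xᵀ⊑y)

  ᵀ⊑ᵀ⇒⊑ : ∀ {x y} → x ᵀ ⊑ y ᵀ → x ⊑ y
  ᵀ⊑ᵀ⇒⊑ {x} {y} xᵀ⊑yᵀ = subst (x ⊑_) (ᵀ-inv y) (ᵀ⊑⇒⊑ᵀ xᵀ⊑yᵀ)

  ᵀ-⊤ : ⊤ ᵀ ≡ ⊤
  ᵀ-⊤ = ⊑-antisym ⊤-greatest (ᵀ⊑⇒⊑ᵀ ⊤-greatest)

  ᵀ-𝟏 : 𝟏 ᵀ ≡ 𝟏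
  ᵀ-𝟏 = begin-equality
    𝟏 ᵀ            ≡⟨ ·-identityʳ (𝟏 ᵀ) ⟨
    𝟏 ᵀ · 𝟏        ≡⟨ cong (𝟏 ᵀ ·_) (ᵀ-inv 𝟏) ⟨
    𝟏 ᵀ · 𝟏 ᵀ ᵀ    ≡⟨ ᵀ-· (𝟏 ᵀ) 𝟏 ⟨
    (𝟏 ᵀ · 𝟏) ᵀ    ≡⟨ cong _ᵀ (·-identityʳ (𝟏 ᵀ)) ⟩
    𝟏 ᵀ ᵀ          ≡⟨ ᵀ-inv 𝟏 ⟩
    𝟏              ∎

  ᵀ-⊓ : ∀ x y → (x ⊓ y) ᵀ ≡ x ᵀ ⊓ y ᵀ
  ᵀ-⊓ x y = ⊑-antisym (⊓-greatest (ᵀ-mono x⊓y⊑x) (ᵀ-mono x⊓y⊑y))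
                      (ᵀ⊑⇒⊑ᵀ (⊓-greatest (⊑ᵀ⇒ᵀ⊑ x⊓y⊑x) (⊑ᵀ⇒ᵀ⊑ x⊓y⊑y)))

  ᵀ-·ᵀ : ∀ x y → (x · y ᵀ) ᵀ ≡ y · x ᵀ
  ᵀ-·ᵀ x y = trans (ᵀ-· x (y ᵀ)) (cong (_· x ᵀ) (ᵀ-inv y))

  ᵀ-ᵀ· : ∀ x y → (x ᵀ · y) ᵀ ≡ y ᵀ · x
  ᵀ-ᵀ· x y = trans (ᵀ-· (x ᵀ) y) (cong (y ᵀ ·_) (ᵀ-inv x))

  dedekindʳ : ∀ x y z → (x · y) ⊓ z ⊑ (x ⊓ z · y ᵀ) · y
  dedekindʳ x y z = ᵀ⊑ᵀ⇒⊑ (begin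
    ((x · y) ⊓ z) ᵀ                  ≡⟨ trans (ᵀ-⊓ (x · y) z) (cong (_⊓ z ᵀ) (ᵀ-· x y)) ⟩
    y ᵀ · x ᵀ ⊓ z ᵀ                  ≤⟨ dedekind (y ᵀ) (x ᵀ) (z ᵀ) ⟩
    y ᵀ · (x ᵀ ⊓ y ᵀ ᵀ · z ᵀ)        ≡⟨ cong (λ w → y ᵀ · (x ᵀ ⊓ w)) (ᵀ-· z (y ᵀ)) ⟨
    y ᵀ · (x ᵀ ⊓ (z · y ᵀ) ᵀ)        ≡⟨ cong (y ᵀ ·_) (ᵀ-⊓ x (z · y ᵀ)) ⟨
    y ᵀ · (x ⊓ z · y ᵀ) ᵀ            ≡⟨ ᵀ-· (x ⊓ z · y ᵀ) y ⟨
    ((x ⊓ z · y ᵀ) · y) ᵀ            ∎)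

  test⇒⊑·ᵀ : ∀ {t} → t ⊑ 𝟏 → t ⊑ t · t ᵀ
  test⇒⊑·ᵀ {t} t⊑𝟏 = begin
    t                   ≡⟨ ⊑⇒⊓≡ t⊑𝟏 ⟨
    t ⊓ 𝟏               ≡⟨ cong (_⊓ 𝟏) (·-identityʳ t) ⟨
    t · 𝟏 ⊓ 𝟏           ≤⟨ dedekind t 𝟏 𝟏 ⟩
    t · (𝟏 ⊓ t ᵀ · 𝟏)   ≤⟨ ·-monoʳ t x⊓y⊑y ⟩
    t · (t ᵀ · 𝟏)       ≡⟨ cong (t ·_) (·-identityʳ (t ᵀ)) ⟩
    t · t ᵀ             ∎

  test-ᵀ : ∀ {t} → t ⊑ 𝟏 → t ᵀ ≡ t
  test-ᵀ {t} t⊑𝟏 = ⊑-antisym (⊑ᵀ⇒ᵀ⊑ t⊑tᵀ) t⊑tᵀ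
    where
    t⊑tᵀ : t ⊑ t ᵀ
    t⊑tᵀ = begin
      t          ≤⟨ test⇒⊑·ᵀ t⊑𝟏 ⟩
      t · t ᵀ    ≤⟨ ·-monoˡ (t ᵀ) t⊑𝟏 ⟩
      𝟏 · t ᵀ    ≡⟨ ·-identityˡ (t ᵀ) ⟩
      t ᵀ        ∎

  test-idem : ∀ {t} → t ⊑ 𝟏 → t · t ≡ t
  test-idem {t} t⊑𝟏 = ⊑-antisym
    (⊑-trans (·-monoʳ t t⊑𝟏) (⊑-reflexive (·-identityʳ t)))
    (subst (λ w → t ⊑ t · w) (test-ᵀ t⊑𝟏) (test⇒⊑·ᵀ t⊑𝟏))

  ᵀ⊓𝟏≡⊓𝟏 : ∀ x → x ᵀ ⊓ 𝟏 ≡ x ⊓ 𝟏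
  ᵀ⊓𝟏≡⊓𝟏 x = begin-equality
    x ᵀ ⊓ 𝟏          ≡⟨ cong (x ᵀ ⊓_) ᵀ-𝟏 ⟨
    x ᵀ ⊓ 𝟏 ᵀ        ≡⟨ ᵀ-⊓ x 𝟏 ⟨
    (x ⊓ 𝟏) ᵀ        ≡⟨ test-ᵀ x⊓y⊑y ⟩
    x ⊓ 𝟏            ∎

  vector-·⊤ : ∀ x → vector (x · ⊤)
  vector-·⊤ x = trans (·-assoc x ⊤ ⊤) (cong (x ·_) ⊤·⊤)

  vector-· : ∀ z {v} → vector v → vector (z · v)
  vector-· z {v} v⊤≡v = trans (·-assoc z v ⊤) (cong (z ·_) v⊤≡v)

  vector-⊓≡test· : ∀ {v} z → vector v → v ⊓ z ≡ (v ⊓ 𝟏) · z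
  vector-⊓≡test· {v} z v⊤≡v = ⊑-antisym
    (begin
      v ⊓ z                  ≡⟨ ⊓-comm v z ⟩
      z ⊓ v                  ≡⟨ cong (_⊓ v) (·-identityˡ z) ⟨
      𝟏 · z ⊓ v              ≤⟨ dedekindʳ 𝟏 z v ⟩
      (𝟏 ⊓ v · z ᵀ) · z      ≤⟨ ·-monoˡ z (⊓-mono ⊑-refl (⊑-trans (·-monoʳ v ⊤-greatest) (⊑-reflexive v⊤≡v))) ⟩
      (𝟏 ⊓ v) · z            ≡⟨ cong (_· z) (⊓-comm 𝟏 v) ⟩
      (v ⊓ 𝟏) · z            ∎)
    (⊓-greatest (⊑-trans (·-mono x⊓y⊑x ⊤-greatest) (⊑-reflexive v⊤≡v))
                (⊑-trans (·-monoˡ z x⊓y⊑y) (⊑-reflexive (·-identityˡ z))))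

  vector-test·⊤ : ∀ {v} → vector v → (v ⊓ 𝟏) · ⊤ ≡ v
  vector-test·⊤ {v} v⊤≡v = trans (sym (vector-⊓≡test· ⊤ v⊤≡v)) (⊓-identityʳ v)

  vector-⊓-· : ∀ {v} a b → vector v → v ⊓ a · b ≡ (v ⊓ a) · b
  vector-⊓-· {v} a b v⊤≡v = begin-equality
    v ⊓ a · b              ≡⟨ vector-⊓≡test· (a · b) v⊤≡v ⟩
    (v ⊓ 𝟏) · (a · b)      ≡⟨ ·-assoc (v ⊓ 𝟏) a b ⟨
    (v ⊓ 𝟏) · a · b        ≡⟨ cong (_· b) (vector-⊓≡test· a v⊤≡v) ⟨
    (v ⊓ a) · b            ∎

  vector-⊓-ᵀ· : ∀ {v} z u → vector v → (v ⊓ z) ᵀ · u ≡ z ᵀ · (v ⊓ u)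
  vector-⊓-ᵀ· {v} z u v⊤≡v = begin-equality
    (v ⊓ z) ᵀ · u              ≡⟨ cong (λ w → w ᵀ · u) (vector-⊓≡test· z v⊤≡v) ⟩
    ((v ⊓ 𝟏) · z) ᵀ · u        ≡⟨ cong (_· u) (ᵀ-· (v ⊓ 𝟏) z) ⟩
    z ᵀ · (v ⊓ 𝟏) ᵀ · u        ≡⟨ cong (λ w → z ᵀ · w · u) (test-ᵀ x⊓y⊑y) ⟩
    z ᵀ · (v ⊓ 𝟏) · u          ≡⟨ ·-assoc (z ᵀ) (v ⊓ 𝟏) u ⟩
    z ᵀ · ((v ⊓ 𝟏) · u)        ≡⟨ cong (z ᵀ ·_) (vector-⊓≡test· u v⊤≡v) ⟨
    z ᵀ · (v ⊓ u)              ∎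

  vector-total : ∀ {v a} → vector v → total a → v ⊓ 𝟏 ⊑ (v ⊓ a) · (v ⊓ a) ᵀ
  vector-total {v} {a} v⊤≡v a-tot = begin
    v ⊓ 𝟏                                  ≤⟨ test⇒⊑·ᵀ x⊓y⊑y ⟩
    (v ⊓ 𝟏) · (v ⊓ 𝟏) ᵀ                    ≡⟨ cong (_· (v ⊓ 𝟏) ᵀ) (·-identityʳ (v ⊓ 𝟏)) ⟨
    (v ⊓ 𝟏) · 𝟏 · (v ⊓ 𝟏) ᵀ                ≤⟨ ·-monoˡ ((v ⊓ 𝟏) ᵀ) (·-monoʳ (v ⊓ 𝟏) a-tot) ⟩
    (v ⊓ 𝟏) · (a · a ᵀ) · (v ⊓ 𝟏) ᵀ        ≡⟨ ·-assoc-middle (v ⊓ 𝟏) a (a ᵀ) ((v ⊓ 𝟏) ᵀ) ⟩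
    (v ⊓ 𝟏) · a · (a ᵀ · (v ⊓ 𝟏) ᵀ)        ≡⟨ cong ((v ⊓ 𝟏) · a ·_) (ᵀ-· (v ⊓ 𝟏) a) ⟨
    (v ⊓ 𝟏) · a · ((v ⊓ 𝟏) · a) ᵀ          ≡⟨ cong (λ m → m · m ᵀ) (vector-⊓≡test· a v⊤≡v) ⟨
    (v ⊓ a) · (v ⊓ a) ᵀ                    ∎

  vector-⊓ : ∀ {u v} → vector u → vector v → vector (u ⊓ v)
  vector-⊓ {u} {v} u⊤≡u v⊤≡v = begin-equality
    (u ⊓ v) · ⊤            ≡⟨ cong (_· ⊤) (vector-⊓≡test· v u⊤≡u) ⟩
    (u ⊓ 𝟏) · v · ⊤        ≡⟨ ·-assoc (u ⊓ 𝟏) v ⊤ ⟩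
    (u ⊓ 𝟏) · (v · ⊤)      ≡⟨ cong ((u ⊓ 𝟏) ·_) v⊤≡v ⟩
    (u ⊓ 𝟏) · v            ≡⟨ vector-⊓≡test· v u⊤≡u ⟨
    u ⊓ v                  ∎

  vector-∁ : ∀ {v} → vector v → vector (∁ v)
  vector-∁ {v} v⊤≡v = ⊑-antisym (⊓≡⊥⇒⊑∁ (x⊑⊥⇒x≡⊥ ∁v⊤⊓v⊑⊥)) x⊑x·⊤
    where
    ∁v⊤⊓v⊑⊥ : ∁ v · ⊤ ⊓ v ⊑ ⊥
    ∁v⊤⊓v⊑⊥ = begin
      ∁ v · ⊤ ⊓ v              ≤⟨ dedekindʳ (∁ v) ⊤ v ⟩
      (∁ v ⊓ v · ⊤ ᵀ) · ⊤      ≡⟨ cong (λ w → (∁ v ⊓ w) · ⊤) (trans (cong (v ·_) ᵀ-⊤) v⊤≡v) ⟩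
      (∁ v ⊓ v) · ⊤            ≡⟨ cong (_· ⊤) (⊓-complementˡ v) ⟩
      ⊥ · ⊤                    ≡⟨ ·-zeroˡ ⊤ ⟩
      ⊥                        ∎

  test·⊤-⊓ : ∀ {t} z → t ⊑ 𝟏 → t · ⊤ ⊓ z ≡ t · z
  test·⊤-⊓ {t} z t⊑𝟏 = trans (vector-⊓≡test· z (vector-·⊤ t)) (cong (_· z) t⊤⊓𝟏≡t)
    where
    t⊤⊓𝟏≡t : t · ⊤ ⊓ 𝟏 ≡ t
    t⊤⊓𝟏≡t = ⊑-antisym
      (begin
        t · ⊤ ⊓ 𝟏              ≤⟨ dedekind t ⊤ 𝟏 ⟩
        t · (⊤ ⊓ t ᵀ · 𝟏)      ≤⟨ ·-monoʳ t x⊓y⊑y ⟩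
        t · (t ᵀ · 𝟏)          ≡⟨ cong (λ w → t · (w · 𝟏)) (test-ᵀ t⊑𝟏) ⟩
        t · (t · 𝟏)            ≡⟨ cong (t ·_) (·-identityʳ t) ⟩
        t · t                  ≡⟨ test-idem t⊑𝟏 ⟩
        t                      ∎)
      (⊓-greatest x⊑x·⊤ t⊑𝟏)

  point-⊓-ᵀ· : ∀ {y} q → point y → y ⊓ (q ᵀ · y) ᵀ ≡ y ⊓ q
  point-⊓-ᵀ· {y} q (y-inj , _ , y⊤≡y) = begin-equality
    y ⊓ (q ᵀ · y) ᵀ            ≡⟨ cong (y ⊓_) (ᵀ-ᵀ· q y) ⟩
    y ⊓ y ᵀ · q                ≡⟨ vector-⊓≡test· (y ᵀ · q) y⊤≡y ⟩
    (y ⊓ 𝟏) · (y ᵀ · q)        ≡⟨ ·-assoc (y ⊓ 𝟏) (y ᵀ) q ⟨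
    (y ⊓ 𝟏) · y ᵀ · q          ≡⟨ cong (_· q) y𝟏yᵀ≡y𝟏 ⟩
    (y ⊓ 𝟏) · q                ≡⟨ vector-⊓≡test· q y⊤≡y ⟨
    y ⊓ q                      ∎
    where
    y𝟏yᵀ≡y𝟏 : (y ⊓ 𝟏) · y ᵀ ≡ y ⊓ 𝟏
    y𝟏yᵀ≡y𝟏 = ⊑-antisym
      (⊓-greatest (⊑-trans (·-monoʳ (y ⊓ 𝟏) ⊤-greatest) (⊑-reflexive (vector-test·⊤ y⊤≡y)))
                  (⊑-trans (·-monoˡ (y ᵀ) x⊓y⊑x) y-inj))
      (begin
        y ⊓ 𝟏                  ≡⟨ test-idem x⊓y⊑y ⟨
        (y ⊓ 𝟏) · (y ⊓ 𝟏)      ≡⟨ cong ((y ⊓ 𝟏) ·_) (test-ᵀ x⊓y⊑y) ⟨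
        (y ⊓ 𝟏) · (y ⊓ 𝟏) ᵀ    ≤⟨ ·-monoʳ (y ⊓ 𝟏) (ᵀ-mono x⊓y⊑x) ⟩
        (y ⊓ 𝟏) · y ᵀ          ∎)

  mapping-· : ∀ {a b} → mapping a → mapping b → mapping (a · b)
  mapping-· {a} {b} (a-univ , a-tot) (b-univ , b-tot) = univ , tot
    where
    univ : (a · b) ᵀ · (a · b) ⊑ 𝟏
    univ = begin
      (a · b) ᵀ · (a · b)        ≡⟨ cong (_· (a · b)) (ᵀ-· a b) ⟩
      b ᵀ · a ᵀ · (a · b)        ≡⟨ ·-assoc-inner (b ᵀ) (a ᵀ) a b ⟩
      b ᵀ · (a ᵀ · a · b)        ≤⟨ ·-monoʳ (b ᵀ) (·-monoˡ b a-univ) ⟩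
      b ᵀ · (𝟏 · b)              ≡⟨ cong (b ᵀ ·_) (·-identityˡ b) ⟩
      b ᵀ · b                    ≤⟨ b-univ ⟩
      𝟏                          ∎
    tot : 𝟏 ⊑ (a · b) · (a · b) ᵀ
    tot = begin
      𝟏                          ≤⟨ a-tot ⟩
      a · a ᵀ                    ≡⟨ cong (_· a ᵀ) (·-identityʳ a) ⟨
      a · 𝟏 · a ᵀ                ≤⟨ ·-monoˡ (a ᵀ) (·-monoʳ a b-tot) ⟩
      a · (b · b ᵀ) · a ᵀ        ≡⟨ ·-assoc-middle a b (b ᵀ) (a ᵀ) ⟩
      a · b · (b ᵀ · a ᵀ)        ≡⟨ cong (a · b ·_) (ᵀ-· a b) ⟨
      (a · b) · (a · b) ᵀ        ∎

  mapping-ᵀ·point : ∀ {p y} → mapping p → point y → point (p ᵀ · y)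
  mapping-ᵀ·point {p} {y} (p-univ , p-tot) (y-inj , y-surj , y⊤≡y) = inj , surj , vector-· (p ᵀ) y⊤≡y
    where
    inj : (p ᵀ · y) · (p ᵀ · y) ᵀ ⊑ 𝟏
    inj = begin
      (p ᵀ · y) · (p ᵀ · y) ᵀ    ≡⟨ cong ((p ᵀ · y) ·_) (ᵀ-ᵀ· p y) ⟩
      (p ᵀ · y) · (y ᵀ · p)      ≡⟨ ·-assoc-inner (p ᵀ) y (y ᵀ) p ⟩
      p ᵀ · (y · y ᵀ · p)        ≤⟨ ·-monoʳ (p ᵀ) (·-monoˡ p y-inj) ⟩
      p ᵀ · (𝟏 · p)              ≡⟨ cong (p ᵀ ·_) (·-identityˡ p) ⟩
      p ᵀ · p                    ≤⟨ p-univ ⟩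
      𝟏                          ∎
    surj : 𝟏 ⊑ (p ᵀ · y) ᵀ · (p ᵀ · y)
    surj = begin
      𝟏                          ≤⟨ y-surj ⟩
      y ᵀ · y                    ≡⟨ cong (_· y) (·-identityʳ (y ᵀ)) ⟨
      y ᵀ · 𝟏 · y                ≤⟨ ·-monoˡ y (·-monoʳ (y ᵀ) p-tot) ⟩
      y ᵀ · (p · p ᵀ) · y        ≡⟨ ·-assoc-middle (y ᵀ) p (p ᵀ) y ⟩
      y ᵀ · p · (p ᵀ · y)        ≡⟨ cong (_· (p ᵀ · y)) (ᵀ-ᵀ· p y) ⟨
      (p ᵀ · y) ᵀ · (p ᵀ · y)    ∎

  ᵀ·⊑⇒·∁⊑∁ : ∀ {p v} → p ᵀ · v ⊑ v → p · ∁ v ⊑ ∁ v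
  ᵀ·⊑⇒·∁⊑∁ {p} {v} pᵀv⊑v = ⊓≡⊥⇒⊑∁ (x⊑⊥⇒x≡⊥ (begin
    p · ∁ v ⊓ v              ≤⟨ dedekind p (∁ v) v ⟩
    p · (∁ v ⊓ p ᵀ · v)      ≤⟨ ·-monoʳ p (⊓-mono ⊑-refl pᵀv⊑v) ⟩
    p · (∁ v ⊓ v)            ≡⟨ cong (p ·_) (⊓-complementˡ v) ⟩
    p · ⊥                    ≡⟨ ·-zeroʳ p ⟩
    ⊥                        ∎))

  vector-⊓⊑·ᵀ : ∀ {p v} → vector v → p ᵀ · v ⊑ v → v ⊓ p ⊑ v · v ᵀ
  vector-⊓⊑·ᵀ {p} {v} v⊤≡v pᵀv⊑v = begin
    v ⊓ p              ≤⟨ ⊓-greatest ⊑-refl (ᵀ⊑⇒⊑ᵀ ⊓ᵀ⊑v) ⟩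
    v ⊓ p ⊓ v ᵀ        ≤⟨ ⊓-mono x⊓y⊑x ⊑-refl ⟩
    v ⊓ v ᵀ            ≡⟨ vector-⊓≡test· (v ᵀ) v⊤≡v ⟩
    (v ⊓ 𝟏) · v ᵀ      ≤⟨ ·-monoˡ (v ᵀ) x⊓y⊑x ⟩
    v · v ᵀ            ∎
    where
    ⊓ᵀ⊑v : (v ⊓ p) ᵀ ⊑ v
    ⊓ᵀ⊑v = begin
      (v ⊓ p) ᵀ          ≤⟨ x⊑x·⊤ ⟩
      (v ⊓ p) ᵀ · ⊤      ≡⟨ vector-⊓-ᵀ· p ⊤ v⊤≡v ⟩
      p ᵀ · (v ⊓ ⊤)      ≡⟨ cong (p ᵀ ·_) (⊓-identityʳ v) ⟩
      p ᵀ · v            ≤⟨ pᵀv⊑v ⟩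
      v                  ∎

  ⊑·injective⇒·ᵀ⊑ : ∀ {z a y} → injective y → z ⊑ a · y → z · z ᵀ ⊑ a · a ᵀ
  ⊑·injective⇒·ᵀ⊑ {z} {a} {y} y-inj z⊑ay = begin
    z · z ᵀ                  ≤⟨ ·-mono z⊑ay (ᵀ-mono z⊑ay) ⟩
    a · y · (a · y) ᵀ        ≡⟨ cong (a · y ·_) (ᵀ-· a y) ⟩
    a · y · (y ᵀ · a ᵀ)      ≡⟨ ·-assoc-inner a y (y ᵀ) (a ᵀ) ⟩
    a · (y · y ᵀ · a ᵀ)      ≤⟨ ·-monoʳ a (·-monoˡ (a ᵀ) y-inj) ⟩
    a · (𝟏 · a ᵀ)            ≡⟨ cong (a ·_) (·-identityˡ (a ᵀ)) ⟩
    a · a ᵀ                  ∎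

  total⇒·⊤≡⊤ : ∀ {p} → total p → p · ⊤ ≡ ⊤
  total⇒·⊤≡⊤ {p} p-tot = ⊑-antisym ⊤-greatest (begin
    ⊤                ≡⟨ ·-identityˡ ⊤ ⟨
    𝟏 · ⊤            ≤⟨ ·-monoˡ ⊤ p-tot ⟩
    p · p ᵀ · ⊤      ≡⟨ ·-assoc p (p ᵀ) ⊤ ⟩
    p · (p ᵀ · ⊤)    ≤⟨ ·-monoʳ p ⊤-greatest ⟩
    p · ⊤            ∎)

  tarski-atom : Tarski → ∀ {y u} → injective y → vector u → u ⊑ y → ¬ u ≡ ⊥ → y ⊑ u
  tarski-atom tarski {y} {u} y-inj u⊤≡u u⊑y u≢⊥ = begin
    y                    ≡⟨ ⊓-identityʳ y ⟨
    y ⊓ ⊤                ≡⟨ cong (y ⊓_) ⊤u≡⊤ ⟨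
    y ⊓ ⊤ · u            ≡⟨ ⊓-comm y (⊤ · u) ⟩
    ⊤ · u ⊓ y            ≤⟨ dedekindʳ ⊤ u y ⟩
    (⊤ ⊓ y · u ᵀ) · u    ≤⟨ ·-monoˡ u x⊓y⊑y ⟩
    y · u ᵀ · u          ≤⟨ ·-monoˡ u (·-monoʳ y (ᵀ-mono u⊑y)) ⟩
    y · y ᵀ · u          ≤⟨ ·-monoˡ u y-inj ⟩
    𝟏 · u                ≡⟨ ·-identityˡ u ⟩
    u                    ∎
    where
    ⊤u≡⊤ : ⊤ · u ≡ ⊤
    ⊤u≡⊤ = trans (cong (⊤ ·_) (sym u⊤≡u)) (trans (sym (·-assoc ⊤ u ⊤)) (tarski u u≢⊥))

  injective-surjective-swap : ∀ {x y} z → injective x → surjective y → y ⊑ z · x → x ⊑ z ᵀ · y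
  injective-surjective-swap {x} {y} z x-inj y-surj y⊑zx = begin
    x               ≡⟨ ·-identityʳ x ⟨
    x · 𝟏           ≤⟨ ·-monoʳ x y-surj ⟩
    x · (y ᵀ · y)   ≡⟨ ·-assoc x (y ᵀ) y ⟨
    x · y ᵀ · y     ≤⟨ ·-monoˡ y (ᵀ⊑⇒⊑ᵀ (subst (_⊑ z) (sym (ᵀ-·ᵀ x y)) y·xᵀ⊑z)) ⟩
    z ᵀ · y         ∎
    where
    y·xᵀ⊑z : y · x ᵀ ⊑ z
    y·xᵀ⊑z = begin
      y · x ᵀ       ≤⟨ ·-monoˡ (x ᵀ) y⊑zx ⟩
      z · x · x ᵀ   ≡⟨ ·-assoc z x (x ᵀ) ⟩
      z · (x · x ᵀ) ≤⟨ ·-monoʳ z x-inj ⟩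
      z · 𝟏         ≡⟨ ·-identityʳ z ⟩
      z             ∎

  𝟏⊑x* : ∀ {x} → 𝟏 ⊑ x *
  𝟏⊑x* {x} = subst (𝟏 ⊑_) (star-unfoldˡ x) x⊑x⊔y

  x·x*⊑x* : ∀ {x} → x · x * ⊑ x *
  x·x*⊑x* {x} = subst (x · x * ⊑_) (star-unfoldˡ x) y⊑x⊔y

  x*·x⊑x* : ∀ {x} → x * · x ⊑ x *
  x*·x⊑x* {x} = subst (x * · x ⊑_) (star-unfoldʳ x) y⊑x⊔y

  x⊑x* : ∀ {x} → x ⊑ x *
  x⊑x* {x} = begin
    x          ≡⟨ ·-identityʳ x ⟨
    x · 𝟏      ≤⟨ ·-monoʳ x 𝟏⊑x* ⟩
    x · x *    ≤⟨ x·x*⊑x* ⟩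
    x *        ∎

  z⊑x*·z : ∀ {x z} → z ⊑ x * · z
  z⊑x*·z {x} {z} = subst (_⊑ x * · z) (·-identityˡ z) (·-monoˡ z 𝟏⊑x*)

  star-leastˡ : ∀ {y z e} → z ⊑ e → y · e ⊑ e → y * · z ⊑ e
  star-leastˡ {y} {z} {e} z⊑e ye⊑e = star-inductˡ e y z (⊔-least z⊑e ye⊑e)

  star-leastʳ : ∀ {y z e} → z ⊑ e → e · y ⊑ e → z · y * ⊑ e
  star-leastʳ {y} {z} {e} z⊑e ey⊑e = star-inductʳ e y z (⊔-least z⊑e ey⊑e)

  star-least : ∀ {y e} → 𝟏 ⊑ e → y · e ⊑ e → y * ⊑ e
  star-least {y} 𝟏⊑e ye⊑e = subst (_⊑ _) (·-identityʳ (y *)) (star-leastˡ 𝟏⊑e ye⊑e)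

  x*·x*⊑x* : ∀ {x} → x * · x * ⊑ x *
  x*·x*⊑x* = star-leastˡ ⊑-refl x·x*⊑x*

  star-least-closure : ∀ {z e} → 𝟏 ⊑ e → e · e ⊑ e → z ⊑ e → z * ⊑ e
  star-least-closure {z} {e} 𝟏⊑e ee⊑e z⊑e = star-least 𝟏⊑e (⊑-trans (·-monoˡ e z⊑e) ee⊑e)

  *-ᵀ : ∀ x → (x *) ᵀ ≡ (x ᵀ) *
  *-ᵀ x = ⊑-antisym (⊑ᵀ⇒ᵀ⊑ (subst (λ w → w * ⊑ ((x ᵀ) *) ᵀ) (ᵀ-inv x) (ᵀ*⊑*ᵀ (x ᵀ)))) (ᵀ*⊑*ᵀ x)
    where
    ᵀ*⊑*ᵀ : ∀ y → (y ᵀ) * ⊑ (y *) ᵀ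
    ᵀ*⊑*ᵀ y = star-least (subst (_⊑ (y *) ᵀ) ᵀ-𝟏 (ᵀ-mono 𝟏⊑x*))
                         (subst (_⊑ (y *) ᵀ) (ᵀ-· (y *) y) (ᵀ-mono x*·x⊑x*))

  x⊑x⁺ : ∀ {x} → x ⊑ x ⁺
  x⊑x⁺ {x} = subst (_⊑ x ⁺) (·-identityʳ x) (·-monoʳ x 𝟏⊑x*)

  x⁺⊑x* : ∀ {x} → x ⁺ ⊑ x *
  x⁺⊑x* = x·x*⊑x*

  x⁺·x⊑x⁺ : ∀ {x} → x ⁺ · x ⊑ x ⁺
  x⁺·x⊑x⁺ {x} = subst (_⊑ x ⁺) (sym (·-assoc x (x *) x)) (·-monoʳ x x*·x⊑x*)

  ⊑⁺⇒⁺⊑⁺ : ∀ {a x} → a ⊑ x ⁺ → a ⁺ ⊑ x ⁺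
  ⊑⁺⇒⁺⊑⁺ {a} {x} a⊑x⁺ = ⊑-trans (·-monoˡ (a *) a⊑x⁺) (star-leastʳ ⊑-refl (begin
    x ⁺ · a              ≤⟨ ·-monoʳ (x ⁺) a⊑x⁺ ⟩
    x · x * · (x · x *)  ≡⟨ ·-assoc-inner x (x *) x (x *) ⟩
    x · (x * · x · x *)  ≤⟨ ·-monoʳ x (⊑-trans (·-monoˡ (x *) x*·x⊑x*) x*·x*⊑x*) ⟩
    x ⁺                  ∎))

  *-unfoldʳ-· : ∀ x y → x * · y ≡ y ⊔ x * · (x · y)
  *-unfoldʳ-· x y = begin-equality
    x * · y                    ≡⟨ cong (_· y) (star-unfoldʳ x) ⟨
    (𝟏 ⊔ x * · x) · y          ≡⟨ ·-distribʳ-⊔ y 𝟏 (x * · x) ⟩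
    𝟏 · y ⊔ x * · x · y        ≡⟨ cong₂ _⊔_ (·-identityˡ y) (·-assoc (x *) x y) ⟩
    y ⊔ x * · (x · y)          ∎

  univalent⇒ᵀ*·*⊑ : ∀ {p} → univalent p → (p ᵀ) * · p * ⊑ p * ⊔ (p ᵀ) *
  univalent⇒ᵀ*·*⊑ {p} p-univ = star-leastˡ x⊑x⊔y (begin
    p ᵀ · (p * ⊔ (p ᵀ) *)                      ≡⟨ ·-distribˡ-⊔ (p ᵀ) (p *) ((p ᵀ) *) ⟩
    p ᵀ · p * ⊔ p ᵀ · (p ᵀ) *                  ≤⟨ ⊔-mono pᵀp*⊑ x·x*⊑x* ⟩
    (p * ⊔ (p ᵀ) *) ⊔ (p ᵀ) *                  ≤⟨ ⊔-least ⊑-refl y⊑x⊔y ⟩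
    p * ⊔ (p ᵀ) *                              ∎)
    where
    pᵀp*⊑ : p ᵀ · p * ⊑ p * ⊔ (p ᵀ) *
    pᵀp*⊑ = begin
      p ᵀ · p *                      ≡⟨ cong (p ᵀ ·_) (star-unfoldˡ p) ⟨
      p ᵀ · (𝟏 ⊔ p · p *)            ≡⟨ ·-distribˡ-⊔ (p ᵀ) 𝟏 (p · p *) ⟩
      p ᵀ · 𝟏 ⊔ p ᵀ · (p · p *)      ≡⟨ cong₂ _⊔_ (·-identityʳ (p ᵀ)) (sym (·-assoc (p ᵀ) p (p *))) ⟩
      p ᵀ ⊔ p ᵀ · p · p *            ≤⟨ ⊔-mono x⊑x* (·-monoˡ (p *) p-univ) ⟩
      (p ᵀ) * ⊔ 𝟏 · p *              ≡⟨ cong ((p ᵀ) * ⊔_) (·-identityˡ (p *)) ⟩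
      (p ᵀ) * ⊔ p *                  ≡⟨ ⊔-comm ((p ᵀ) *) (p *) ⟩
      p * ⊔ (p ᵀ) *                  ∎

  ᵀ-*·ᵀ* : ∀ x → (x * · (x ᵀ) *) ᵀ ≡ x * · (x ᵀ) *
  ᵀ-*·ᵀ* x = begin-equality
    (x * · (x ᵀ) *) ᵀ            ≡⟨ ᵀ-· (x *) ((x ᵀ) *) ⟩
    ((x ᵀ) *) ᵀ · (x *) ᵀ        ≡⟨ cong₂ _·_ (trans (*-ᵀ (x ᵀ)) (cong _* (ᵀ-inv x))) (*-ᵀ x) ⟩
    x * · (x ᵀ) *                ∎

  univalent⇒*·ᵀ*-transitive : ∀ {p} → univalent p → (p * · (p ᵀ) *) · (p * · (p ᵀ) *) ⊑ p * · (p ᵀ) *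
  univalent⇒*·ᵀ*-transitive {p} p-univ = begin
    (p * · (p ᵀ) *) · (p * · (p ᵀ) *)          ≡⟨ ·-assoc-inner (p *) ((p ᵀ) *) (p *) ((p ᵀ) *) ⟩
    p * · ((p ᵀ) * · p * · (p ᵀ) *)            ≤⟨ ·-monoʳ (p *) (·-monoˡ ((p ᵀ) *) (univalent⇒ᵀ*·*⊑ p-univ)) ⟩
    p * · ((p * ⊔ (p ᵀ) *) · (p ᵀ) *)          ≡⟨ cong (p * ·_) (·-distribʳ-⊔ ((p ᵀ) *) (p *) ((p ᵀ) *)) ⟩
    p * · (p * · (p ᵀ) * ⊔ (p ᵀ) * · (p ᵀ) *)  ≤⟨ ·-monoʳ (p *) (⊔-least ⊑-refl (⊑-trans x*·x*⊑x* z⊑x*·z)) ⟩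
    p * · (p * · (p ᵀ) *)                      ≡⟨ ·-assoc (p *) (p *) ((p ᵀ) *) ⟨
    p * · p * · (p ᵀ) *                        ≤⟨ ·-monoˡ ((p ᵀ) *) x*·x*⊑x* ⟩
    p * · (p ᵀ) *                              ∎

module Forest (K : KleeneRelationAlgebra) {p : KleeneRelationAlgebra.S K}
              (p-forest : KleeneRelationAlgebra.forest K p) where
  open RelationAlgebra K
  open ⊑-Reasoning

  roots nonroots : S
  roots = p ⊓ 𝟏
  nonroots = p ⊓ ∁ 𝟏

  univalent-p : univalent p
  univalent-p = proj₁ (proj₁ p-forest)

  roots⊑𝟏 : roots ⊑ 𝟏
  roots⊑𝟏 = x⊓y⊑y

  roots·nonroots≡⊥ : roots · nonroots ≡ ⊥
  roots·nonroots≡⊥ = ⊑-⊑∁⇒≡⊥ below-𝟏 below-∁𝟏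
    where
    below-∁𝟏 : roots · nonroots ⊑ ∁ 𝟏
    below-∁𝟏 = begin
      roots · nonroots       ≤⟨ ·-monoˡ nonroots roots⊑𝟏 ⟩
      𝟏 · nonroots           ≡⟨ ·-identityˡ nonroots ⟩
      p ⊓ ∁ 𝟏                ≤⟨ x⊓y⊑y ⟩
      ∁ 𝟏                    ∎
    below-𝟏 : roots · nonroots ⊑ 𝟏
    below-𝟏 = begin
      roots · nonroots       ≡⟨ cong (_· nonroots) (test-ᵀ roots⊑𝟏) ⟨
      roots ᵀ · nonroots     ≤⟨ ·-mono (ᵀ-mono x⊓y⊑x) x⊓y⊑x ⟩
      p ᵀ · p                ≤⟨ univalent-p ⟩
      𝟏                      ∎

  roots·p⊑roots : roots · p ⊑ roots
  roots·p⊑roots = begin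
    roots · p                              ≡⟨ cong (roots ·_) (⊓-∁-split p 𝟏) ⟩
    roots · (roots ⊔ nonroots)             ≡⟨ ·-distribˡ-⊔ roots roots nonroots ⟩
    roots · roots ⊔ roots · nonroots       ≡⟨ cong₂ _⊔_ (test-idem roots⊑𝟏) roots·nonroots≡⊥ ⟩
    roots ⊔ ⊥                              ≡⟨ ⊔-identityʳ roots ⟩
    roots                                  ∎

  roots·p*⊑roots : roots · p * ⊑ roots
  roots·p*⊑roots = star-leastʳ ⊑-refl roots·p⊑roots

  p⁺⊑nonroots⁺⊔roots : p ⁺ ⊑ nonroots ⁺ ⊔ roots
  p⁺⊑nonroots⁺⊔roots = star-leastʳ p⊑ (begin
    (nonroots ⁺ ⊔ roots) · p                         ≡⟨ ·-distribʳ-⊔ p (nonroots ⁺) roots ⟩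
    nonroots ⁺ · p ⊔ roots · p                       ≤⟨ ⊔-mono nonroots⁺·p⊑ roots·p⊑roots ⟩
    nonroots ⁺ ⊔ roots                               ∎)
    where
    p⊑ : p ⊑ nonroots ⁺ ⊔ roots
    p⊑ = subst (_⊑ nonroots ⁺ ⊔ roots) (sym (trans (⊓-∁-split p 𝟏) (⊔-comm roots nonroots))) (⊔-mono x⊑x⁺ ⊑-refl)
    nonroots⁺·p⊑ : nonroots ⁺ · p ⊑ nonroots ⁺
    nonroots⁺·p⊑ = begin
      nonroots ⁺ · p                                 ≡⟨ cong (nonroots ⁺ ·_) (⊓-∁-split p 𝟏) ⟩
      nonroots ⁺ · (roots ⊔ nonroots)                ≡⟨ ·-distribˡ-⊔ (nonroots ⁺) roots nonroots ⟩
      nonroots ⁺ · roots ⊔ nonroots ⁺ · nonroots     ≤⟨ ⊔-mono (·-monoʳ (nonroots ⁺) roots⊑𝟏) x⁺·x⊑x⁺ ⟩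
      nonroots ⁺ · 𝟏 ⊔ nonroots ⁺                    ≡⟨ trans (cong (_⊔ nonroots ⁺) (·-identityʳ (nonroots ⁺))) (⊔-idem (nonroots ⁺)) ⟩
      nonroots ⁺                                     ∎

  p⁺⊓𝟏⊑roots : p ⁺ ⊓ 𝟏 ⊑ roots
  p⁺⊓𝟏⊑roots = ⊑∁⊔⇒⊓⊑ (⊑-trans p⁺⊑nonroots⁺⊔roots (⊔-mono (proj₂ p-forest) ⊑-refl))

  ⊓⁺ᵀ·⊑roots· : ∀ {y} → injective y → y ⊓ (p ⁺) ᵀ · y ⊑ roots · y
  ⊓⁺ᵀ·⊑roots· {y} y-inj = begin
    y ⊓ (p ⁺) ᵀ · y              ≡⟨ ⊓-comm y ((p ⁺) ᵀ · y) ⟩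
    (p ⁺) ᵀ · y ⊓ y              ≤⟨ dedekindʳ ((p ⁺) ᵀ) y y ⟩
    ((p ⁺) ᵀ ⊓ y · y ᵀ) · y      ≤⟨ ·-monoˡ y (⊓-mono ⊑-refl y-inj) ⟩
    ((p ⁺) ᵀ ⊓ 𝟏) · y            ≡⟨ cong (_· y) (ᵀ⊓𝟏≡⊓𝟏 (p ⁺)) ⟩
    (p ⁺ ⊓ 𝟏) · y                ≤⟨ ·-monoˡ y p⁺⊓𝟏⊑roots ⟩
    roots · y                    ∎

  ⊑roots·⇒ᵀ·≡ : ∀ {y} → y ⊑ roots · y → p ᵀ · y ≡ y
  ⊑roots·⇒ᵀ·≡ {y} y⊑roots·y = ⊑-antisym
    (begin
      p ᵀ · y                ≤⟨ ·-monoʳ (p ᵀ) (⊑-trans y⊑roots·y (·-monoˡ y x⊓y⊑x)) ⟩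
      p ᵀ · (p · y)          ≡⟨ ·-assoc (p ᵀ) p y ⟨
      p ᵀ · p · y            ≤⟨ ·-monoˡ y univalent-p ⟩
      𝟏 · y                  ≡⟨ ·-identityˡ y ⟩
      y                      ∎)
    (begin
      y                      ≤⟨ y⊑roots·y ⟩
      roots · y              ≡⟨ cong (_· y) (test-ᵀ roots⊑𝟏) ⟨
      roots ᵀ · y            ≤⟨ ·-monoˡ y (ᵀ-mono x⊓y⊑x) ⟩
      p ᵀ · y                ∎)

  ⊑p⁺⇒acyclic-⊓∁𝟏 : ∀ {z} → z ⊑ p ⁺ → acyclic (z ⊓ ∁ 𝟏)
  ⊑p⁺⇒acyclic-⊓∁𝟏 {z} z⊑p⁺ = ⊑-trans (⊑⁺⇒⁺⊑⁺ z⊓∁𝟏⊑) (proj₂ p-forest)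
    where
    z⊓∁𝟏⊑ : z ⊓ ∁ 𝟏 ⊑ nonroots ⁺
    z⊓∁𝟏⊑ = ⊑∁⊔⇒⊓⊑ (begin
      z                                ≤⟨ z⊑p⁺ ⟩
      p ⁺                              ≤⟨ p⁺⊑nonroots⁺⊔roots ⟩
      nonroots ⁺ ⊔ roots               ≤⟨ ⊔-least y⊑x⊔y (⊑-trans roots⊑𝟏 (⊑-trans (⊑-reflexive (sym (∁-involutive 𝟏))) x⊑x⊔y)) ⟩
      ∁ (∁ 𝟏) ⊔ nonroots ⁺             ∎)

module ArrayUpdate (K : KleeneRelationAlgebra) where
  open RelationAlgebra K

  update : S → S → S → S
  update w a b = (w ⊓ a) ⊔ (∁ w ⊓ b)

  update-⊥ : ∀ a b → update ⊥ a b ≡ b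
  update-⊥ a b = begin
    (⊥ ⊓ a) ⊔ (∁ ⊥ ⊓ b)   ≡⟨ cong₂ _⊔_ (⊓-zeroˡ a) (cong (_⊓ b) ∁⊥≡⊤) ⟩
    ⊥ ⊔ (⊤ ⊓ b)           ≡⟨ ⊔-identityˡ (⊤ ⊓ b) ⟩
    ⊤ ⊓ b                 ≡⟨ ⊓-identityˡ b ⟩
    b                     ∎
    where open ≡-Reasoning

  update-idem : ∀ w a → update w a a ≡ a
  update-idem w a = sym (trans (⊓-∁-split a w) (cong₂ _⊔_ (⊓-comm a w) (⊓-comm a (∁ w))))

  update-⊓ : ∀ w a b c → update w a b ⊓ c ≡ update w (a ⊓ c) (b ⊓ c)
  update-⊓ w a b c = trans (⊓-distribʳ-⊔ c (w ⊓ a) (∁ w ⊓ b)) (cong₂ _⊔_ (⊓-assoc w a c) (⊓-assoc (∁ w) b c))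

  update⊑⊔ : ∀ w a b → update w a b ⊑ a ⊔ b
  update⊑⊔ w a b = ⊔-mono x⊓y⊑y x⊓y⊑y

  ⊓-update : ∀ y w a b → y ⊓ update w a b ≡ (y ⊓ w ⊓ a) ⊔ (y ⊓ ∁ w ⊓ b)
  ⊓-update y w a b =
    trans (⊓-distribˡ-⊔ y (w ⊓ a) (∁ w ⊓ b)) (sym (cong₂ _⊔_ (⊓-assoc y w a) (⊓-assoc y (∁ w) b)))

  ⊓-update-inside : ∀ {y w} a b → y ⊑ w → y ⊓ update w a b ≡ y ⊓ a
  ⊓-update-inside {y} {w} a b y⊑w = begin
    y ⊓ update w a b                 ≡⟨ ⊓-update y w a b ⟩
    (y ⊓ w ⊓ a) ⊔ (y ⊓ ∁ w ⊓ b)      ≡⟨ cong₂ _⊔_ (cong (_⊓ a) (⊑⇒⊓≡ y⊑w))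
                                                  (trans (cong (_⊓ b) (⊑-⊑∁⇒⊓≡⊥ y⊑w ⊑-refl)) (⊓-zeroˡ b)) ⟩
    (y ⊓ a) ⊔ ⊥                      ≡⟨ ⊔-identityʳ (y ⊓ a) ⟩
    y ⊓ a                            ∎
    where open ≡-Reasoning

  ⊓-update-outside : ∀ {y w} a b → y ⊓ w ≡ ⊥ → y ⊓ update w a b ≡ y ⊓ b
  ⊓-update-outside {y} {w} a b y⊓w≡⊥ = begin
    y ⊓ update w a b                 ≡⟨ ⊓-update y w a b ⟩
    (y ⊓ w ⊓ a) ⊔ (y ⊓ ∁ w ⊓ b)      ≡⟨ cong₂ _⊔_ (trans (cong (_⊓ a) y⊓w≡⊥) (⊓-zeroˡ a))
                                                  (cong (_⊓ b) (⊑⇒⊓≡ (⊓≡⊥⇒⊑∁ y⊓w≡⊥))) ⟩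
    ⊥ ⊔ (y ⊓ b)                      ≡⟨ ⊔-identityˡ (y ⊓ b) ⟩
    y ⊓ b                            ∎
    where open ≡-Reasoning

  update-⊔ : ∀ {y w} a b → y ⊓ w ≡ ⊥ → (y ⊓ a) ⊔ (∁ y ⊓ update w a b) ≡ update (y ⊔ w) a b
  update-⊔ {y} {w} a b y⊓w≡⊥ = begin
    (y ⊓ a) ⊔ (∁ y ⊓ update w a b)
      ≡⟨ cong ((y ⊓ a) ⊔_) (⊓-update (∁ y) w a b) ⟩
    (y ⊓ a) ⊔ ((∁ y ⊓ w ⊓ a) ⊔ (∁ y ⊓ ∁ w ⊓ b))
      ≡⟨ cong₂ (λ m n → (y ⊓ a) ⊔ ((m ⊓ a) ⊔ (n ⊓ b))) ∁y⊓w≡w (sym (∁-⊔ y w)) ⟩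
    (y ⊓ a) ⊔ ((w ⊓ a) ⊔ (∁ (y ⊔ w) ⊓ b))
      ≡⟨ ⊔-assoc (y ⊓ a) (w ⊓ a) (∁ (y ⊔ w) ⊓ b) ⟨
    ((y ⊓ a) ⊔ (w ⊓ a)) ⊔ (∁ (y ⊔ w) ⊓ b)
      ≡⟨ cong (_⊔ (∁ (y ⊔ w) ⊓ b)) (⊓-distribʳ-⊔ a y w) ⟨
    update (y ⊔ w) a b
      ∎
    where
    open ≡-Reasoning
    ∁y⊓w≡w : ∁ y ⊓ w ≡ w
    ∁y⊓w≡w = trans (⊓-comm (∁ y) w) (⊑⇒⊓≡ (⊓≡⊥⇒⊑∁ (trans (⊓-comm w y) y⊓w≡⊥)))

  update-⊔-agree : ∀ {y w} a b → y ⊓ w ≡ ⊥ → y ⊓ a ≡ y ⊓ b → update w a b ≡ update (y ⊔ w) a b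
  update-⊔-agree {y} {w} a b y⊓w≡⊥ y⊓a≡y⊓b = begin
    update w a b                                  ≡⟨ ⊓-∁-split (update w a b) y ⟩
    (update w a b ⊓ y) ⊔ (update w a b ⊓ ∁ y)     ≡⟨ cong₂ _⊔_ (⊓-comm (update w a b) y) (⊓-comm (update w a b) (∁ y)) ⟩
    (y ⊓ update w a b) ⊔ (∁ y ⊓ update w a b)     ≡⟨ cong (_⊔ (∁ y ⊓ update w a b)) y⊓update≡y⊓a ⟩
    (y ⊓ a) ⊔ (∁ y ⊓ update w a b)                ≡⟨ update-⊔ a b y⊓w≡⊥ ⟩
    update (y ⊔ w) a b                            ∎
    where
    open ≡-Reasoning
    y⊓update≡y⊓a : y ⊓ update w a b ≡ y ⊓ a
    y⊓update≡y⊓a = trans (⊓-update-outside a b y⊓w≡⊥) (sym y⊓a≡y⊓b)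

  update-ᵀ· : ∀ {w} a b z → vector w → update w a b ᵀ · z ≡ a ᵀ · (w ⊓ z) ⊔ b ᵀ · (∁ w ⊓ z)
  update-ᵀ· {w} a b z w⊤≡w = begin
    update w a b ᵀ · z                     ≡⟨ cong (_· z) (ᵀ-⊔ (w ⊓ a) (∁ w ⊓ b)) ⟩
    ((w ⊓ a) ᵀ ⊔ (∁ w ⊓ b) ᵀ) · z          ≡⟨ ·-distribʳ-⊔ z ((w ⊓ a) ᵀ) ((∁ w ⊓ b) ᵀ) ⟩
    (w ⊓ a) ᵀ · z ⊔ (∁ w ⊓ b) ᵀ · z        ≡⟨ cong₂ _⊔_ (vector-⊓-ᵀ· a z w⊤≡w) (vector-⊓-ᵀ· b z (vector-∁ w⊤≡w)) ⟩
    a ᵀ · (w ⊓ z) ⊔ b ᵀ · (∁ w ⊓ z)        ∎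
    where open ≡-Reasoning

  update-ᵀ·-outside : ∀ {w z} a b → vector w → z ⊓ w ≡ ⊥ → update w a b ᵀ · z ≡ b ᵀ · z
  update-ᵀ·-outside {w} {z} a b w⊤≡w z⊓w≡⊥ = begin
    update w a b ᵀ · z                     ≡⟨ update-ᵀ· a b z w⊤≡w ⟩
    a ᵀ · (w ⊓ z) ⊔ b ᵀ · (∁ w ⊓ z)        ≡⟨ cong₂ (λ m n → a ᵀ · m ⊔ b ᵀ · n) w⊓z≡⊥ ∁w⊓z≡z ⟩
    a ᵀ · ⊥ ⊔ b ᵀ · z                      ≡⟨ cong (_⊔ b ᵀ · z) (·-zeroʳ (a ᵀ)) ⟩
    ⊥ ⊔ b ᵀ · z                            ≡⟨ ⊔-identityˡ (b ᵀ · z) ⟩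
    b ᵀ · z                                ∎
    where
    open ≡-Reasoning
    w⊓z≡⊥ : w ⊓ z ≡ ⊥
    w⊓z≡⊥ = trans (⊓-comm w z) z⊓w≡⊥
    ∁w⊓z≡z : ∁ w ⊓ z ≡ z
    ∁w⊓z≡z = trans (⊓-comm (∁ w) z) (⊑⇒⊓≡ (⊓≡⊥⇒⊑∁ z⊓w≡⊥))

  update-mapping : ∀ {w a b} → vector w → mapping a → mapping b → mapping (update w a b)
  update-mapping {w} {a} {b} w⊤≡w (a-univ , a-tot) (b-univ , b-tot) = univ , tot
    where
    open ⊑-Reasoning
    u : S
    u = update w a b
    univ : u ᵀ · u ⊑ 𝟏
    univ = begin
      u ᵀ · u                                ≡⟨ update-ᵀ· a b u w⊤≡w ⟩
      a ᵀ · (w ⊓ u) ⊔ b ᵀ · (∁ w ⊓ u)        ≡⟨ cong₂ (λ m n → a ᵀ · m ⊔ b ᵀ · n) (⊓-update-inside a b ⊑-refl)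
                                                                             (⊓-update-outside a b (⊓-complementˡ w)) ⟩
      a ᵀ · (w ⊓ a) ⊔ b ᵀ · (∁ w ⊓ b)        ≤⟨ ⊔-mono (·-monoʳ (a ᵀ) x⊓y⊑y) (·-monoʳ (b ᵀ) x⊓y⊑y) ⟩
      a ᵀ · a ⊔ b ᵀ · b                      ≤⟨ ⊔-least a-univ b-univ ⟩
      𝟏                                      ∎
    tot : 𝟏 ⊑ u · u ᵀ
    tot = begin
      𝟏                                              ≡⟨ update-idem w 𝟏 ⟨
      (w ⊓ 𝟏) ⊔ (∁ w ⊓ 𝟏)                            ≤⟨ ⊔-mono (vector-total w⊤≡w a-tot) (vector-total (vector-∁ w⊤≡w) b-tot) ⟩
      (w ⊓ a) · (w ⊓ a) ᵀ ⊔ (∁ w ⊓ b) · (∁ w ⊓ b) ᵀ  ≤⟨ ⊔-least (·-mono x⊑x⊔y (ᵀ-mono x⊑x⊔y)) (·-mono y⊑x⊔y (ᵀ-mono y⊑x⊔y)) ⟩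
      u · u ᵀ                                        ∎

module PathHalving (K : KleeneRelationAlgebra) (tarski : KleeneRelationAlgebra.Tarski K)
                   (_≟_ : DecidableEquality (KleeneRelationAlgebra.S K))
                   {p₀ x : KleeneRelationAlgebra.S K}
                   (p₀-forest : KleeneRelationAlgebra.forest K p₀)
                   (x-point : KleeneRelationAlgebra.point K x) where
  open RelationAlgebra K
  open ArrayUpdate K
  open Forest K p₀-forest
  open ⊑-Reasoning

  ancestors : S → S
  ancestors z = (p₀ ᵀ) * · z

  v : S
  v = ancestors x

  -- The nodes of the path v strictly below y, i.e. those already redirected to their grandparent.
  halved : S → S
  halved y = v ⊓ ∁ (ancestors y)

  halve : S → S
  halve w = update w (p₀ · p₀) p₀

  Invariant : State → Set
  Invariant ⟨ p , _ , y ⟩ = point y × y ⊑ v × p ≡ halve (halved y)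

  mapping-p₀ : mapping p₀
  mapping-p₀ = proj₁ p₀-forest

  vector-v : vector v
  vector-v = vector-· ((p₀ ᵀ) *) (proj₂ (proj₂ x-point))

  vector-halved : ∀ {y} → vector y → vector (halved y)
  vector-halved y⊤≡y = vector-⊓ vector-v (vector-∁ (vector-· ((p₀ ᵀ) *) y⊤≡y))

  ⊑ancestors : ∀ {z} → z ⊑ ancestors z
  ⊑ancestors = z⊑x*·z

  parent-ancestors⊑ : ∀ z → p₀ ᵀ · ancestors z ⊑ ancestors z
  parent-ancestors⊑ z = subst (_⊑ ancestors z) (·-assoc (p₀ ᵀ) ((p₀ ᵀ) *) z) (·-monoˡ z x·x*⊑x*)

  parent⊑ancestors : ∀ {z} → p₀ ᵀ · z ⊑ ancestors z
  parent⊑ancestors {z} = ⊑-trans (·-monoʳ (p₀ ᵀ) ⊑ancestors) (parent-ancestors⊑ z)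

  ⊑ancestors⇒⊓halved≡⊥ : ∀ {z y} → z ⊑ ancestors y → z ⊓ halved y ≡ ⊥
  ⊑ancestors⇒⊓halved≡⊥ z⊑ancestors = ⊑-⊑∁⇒⊓≡⊥ z⊑ancestors x⊓y⊑y

  halve-ᵀ· : ∀ {y z} → vector y → z ⊑ ancestors y → halve (halved y) ᵀ · z ≡ p₀ ᵀ · z
  halve-ᵀ· y⊤≡y z⊑ancestors =
    update-ᵀ·-outside (p₀ · p₀) p₀ (vector-halved y⊤≡y) (⊑ancestors⇒⊓halved≡⊥ z⊑ancestors)

  invariant-init : ∀ t → Invariant ⟨ p₀ , t , x ⟩
  invariant-init _ = x-point , ⊑ancestors ,
    sym (trans (cong halve (⊓-complementʳ v)) (update-⊥ (p₀ · p₀) p₀))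

  ancestors-parent : ∀ y → ancestors (p₀ ᵀ · y) ≡ (p₀ ⁺) ᵀ · y
  ancestors-parent y = begin-equality
    (p₀ ᵀ) * · (p₀ ᵀ · y)      ≡⟨ ·-assoc ((p₀ ᵀ) *) (p₀ ᵀ) y ⟨
    (p₀ ᵀ) * · p₀ ᵀ · y        ≡⟨ cong (_· y) (trans (ᵀ-· p₀ (p₀ *)) (cong (_· p₀ ᵀ) (*-ᵀ p₀))) ⟨
    (p₀ ⁺) ᵀ · y               ∎

  -- By the Tarski rule the vector roots · y ⊑ y is either ⊥ or all of y, i.e. y is a root.
  nonroot⇒⊓ancestors-parent≡⊥ : ∀ {y} → point y → ¬ y ≡ p₀ ᵀ · y → y ⊓ ancestors (p₀ ᵀ · y) ≡ ⊥
  nonroot⇒⊓ancestors-parent≡⊥ {y} (y-inj , _ , y⊤≡y) y≢parent with (roots · y) ≟ ⊥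
  ... | yes roots·y≡⊥ = x⊑⊥⇒x≡⊥ (begin
    y ⊓ ancestors (p₀ ᵀ · y)   ≡⟨ cong (y ⊓_) (ancestors-parent y) ⟩
    y ⊓ (p₀ ⁺) ᵀ · y           ≤⟨ ⊓⁺ᵀ·⊑roots· y-inj ⟩
    roots · y                  ≡⟨ roots·y≡⊥ ⟩
    ⊥                          ∎)
  ... | no roots·y≢⊥ = contradiction (sym (⊑roots·⇒ᵀ·≡ y⊑roots·y)) y≢parent
    where
    y⊑roots·y : y ⊑ roots · y
    y⊑roots·y = tarski-atom tarski y-inj (vector-· roots y⊤≡y)
                  (⊑-trans (·-monoˡ y roots⊑𝟏) (⊑-reflexive (·-identityˡ y))) roots·y≢⊥

  halved-parent : ∀ {y} → y ⊑ v → y ⊓ ancestors (p₀ ᵀ · y) ≡ ⊥ → halved (p₀ ᵀ · y) ≡ y ⊔ halved y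
  halved-parent {y} y⊑v y⊓a≡⊥ = begin-equality
    v ⊓ ∁ a                                  ≡⟨ ⊓-∁-split (v ⊓ ∁ a) y ⟩
    (v ⊓ ∁ a ⊓ y) ⊔ (v ⊓ ∁ a ⊓ ∁ y)          ≡⟨ cong₂ _⊔_ (trans (⊓-comm _ y) (⊑⇒⊓≡ (⊓-greatest y⊑v (⊓≡⊥⇒⊑∁ y⊓a≡⊥))))
                                                          (⊓-assoc v (∁ a) (∁ y)) ⟩
    y ⊔ (v ⊓ (∁ a ⊓ ∁ y))                    ≡⟨ cong (λ m → y ⊔ (v ⊓ m)) (∁-⊔ a y) ⟨
    y ⊔ (v ⊓ ∁ (a ⊔ y))                      ≡⟨ cong (λ m → y ⊔ (v ⊓ ∁ m)) (trans (⊔-comm a y) (sym (*-unfoldʳ-· (p₀ ᵀ) y))) ⟩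
    y ⊔ halved y                             ∎
    where
    a : S
    a = ancestors (p₀ ᵀ · y)

  invariant-step : ∀ {p t y} → Invariant ⟨ p , t , y ⟩ → ¬ y ≡ p ᵀ · y →
                   Invariant (body ⟨ p , t , y ⟩) × halved y ⊏ halved (p ᵀ · y)
  invariant-step {p} {t} {y} (y-point , y⊑v , p≡) y≢pᵀy =
    (subst point (sym parent) (mapping-ᵀ·point mapping-p₀ y-point) ,
     subst (_⊑ v) (sym parent) (⊑-trans (·-monoʳ (p₀ ᵀ) y⊑v) (parent-ancestors⊑ x)) ,
     halving) ,
    grows
    where
    y⊤≡y : vector y
    y⊤≡y = proj₂ (proj₂ y-point)

    parent : p ᵀ · y ≡ p₀ ᵀ · y
    parent = trans (cong (λ m → m ᵀ · y) p≡) (halve-ᵀ· y⊤≡y ⊑ancestors)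

    grandparent : p ᵀ · p ᵀ · y ≡ (p₀ · p₀) ᵀ · y
    grandparent = begin-equality
      p ᵀ · p ᵀ · y          ≡⟨ trans (·-assoc (p ᵀ) (p ᵀ) y) (cong (p ᵀ ·_) parent) ⟩
      p ᵀ · (p₀ ᵀ · y)       ≡⟨ cong (λ m → m ᵀ · (p₀ ᵀ · y)) p≡ ⟩
      halve (halved y) ᵀ · (p₀ ᵀ · y)  ≡⟨ halve-ᵀ· y⊤≡y parent⊑ancestors ⟩
      p₀ ᵀ · (p₀ ᵀ · y)      ≡⟨ ·-assoc (p₀ ᵀ) (p₀ ᵀ) y ⟨
      p₀ ᵀ · p₀ ᵀ · y        ≡⟨ cong (_· y) (ᵀ-· p₀ p₀) ⟨
      (p₀ · p₀) ᵀ · y        ∎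

    y⊓halved≡⊥ : y ⊓ halved y ≡ ⊥
    y⊓halved≡⊥ = ⊑ancestors⇒⊓halved≡⊥ ⊑ancestors

    halved-next : halved (p ᵀ · y) ≡ y ⊔ halved y
    halved-next = trans (cong halved parent)
      (halved-parent y⊑v (nonroot⇒⊓ancestors-parent≡⊥ y-point (λ e → y≢pᵀy (trans e (sym parent)))))

    halving : (y ⊓ (p ᵀ · p ᵀ · y) ᵀ) ⊔ (∁ y ⊓ p) ≡ halve (halved (p ᵀ · y))
    halving = begin-equality
      (y ⊓ (p ᵀ · p ᵀ · y) ᵀ) ⊔ (∁ y ⊓ p)                  ≡⟨ cong₂ (λ m n → (y ⊓ m ᵀ) ⊔ (∁ y ⊓ n)) grandparent p≡ ⟩
      (y ⊓ ((p₀ · p₀) ᵀ · y) ᵀ) ⊔ (∁ y ⊓ halve (halved y))  ≡⟨ cong (_⊔ (∁ y ⊓ halve (halved y))) (point-⊓-ᵀ· (p₀ · p₀) y-point) ⟩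
      (y ⊓ p₀ · p₀) ⊔ (∁ y ⊓ halve (halved y))              ≡⟨ update-⊔ (p₀ · p₀) p₀ y⊓halved≡⊥ ⟩
      halve (y ⊔ halved y)                                  ≡⟨ cong halve halved-next ⟨
      halve (halved (p ᵀ · y))                              ∎

    y≢⊥ : ¬ y ≡ ⊥
    y≢⊥ y≡⊥ = y≢pᵀy (trans y≡⊥ (sym (trans (cong (p ᵀ ·_) y≡⊥) (·-zeroʳ (p ᵀ)))))

    grows : halved y ⊏ halved (p ᵀ · y)
    grows = subst (halved y ⊏_) (sym halved-next) (y⊑x⊔y ,
      λ e → y≢⊥ (trans (sym (⊑⇒⊓≡ (subst (y ⊑_) (sym e) x⊑x⊔y))) y⊓halved≡⊥))

  module Root {y : S} (y-point : point y) (y⊑v : y ⊑ v) (y-root : p₀ ᵀ · y ≡ y) where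
    y-inj : injective y
    y-inj = proj₁ y-point

    y⊤≡y : vector y
    y⊤≡y = proj₂ (proj₂ y-point)

    P : S
    P = halve v

    ᵀ·root⇒⊓≡⊓ᵀ : ∀ q → q ᵀ · y ≡ y → y ⊓ q ≡ y ⊓ y ᵀ
    ᵀ·root⇒⊓≡⊓ᵀ q qᵀy≡y = trans (sym (point-⊓-ᵀ· q y-point)) (cong (λ m → y ⊓ m ᵀ) qᵀy≡y)

    ancestors-y : ancestors y ≡ y
    ancestors-y = ⊑-antisym (star-leastˡ ⊑-refl (⊑-reflexive y-root)) ⊑ancestors

    halve-halved≡P : halve (halved y) ≡ P
    halve-halved≡P = begin-equality
      halve (v ⊓ ∁ (ancestors y))      ≡⟨ cong (λ m → halve (v ⊓ ∁ m)) ancestors-y ⟩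
      halve (v ⊓ ∁ y)                  ≡⟨ update-⊔-agree (p₀ · p₀) p₀ (⊑-⊑∁⇒⊓≡⊥ ⊑-refl x⊓y⊑y) y⊓p₀p₀≡y⊓p₀ ⟩
      halve (y ⊔ (v ⊓ ∁ y))            ≡⟨ cong halve y⊔v⊓∁y≡v ⟩
      P                                ∎
      where
      y⊓p₀p₀≡y⊓p₀ : y ⊓ p₀ · p₀ ≡ y ⊓ p₀
      y⊓p₀p₀≡y⊓p₀ = trans (ᵀ·root⇒⊓≡⊓ᵀ (p₀ · p₀) (begin-equality
        (p₀ · p₀) ᵀ · y        ≡⟨ trans (cong (_· y) (ᵀ-· p₀ p₀)) (·-assoc (p₀ ᵀ) (p₀ ᵀ) y) ⟩
        p₀ ᵀ · (p₀ ᵀ · y)      ≡⟨ trans (cong (p₀ ᵀ ·_) y-root) y-root ⟩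
        y                      ∎)) (sym (ᵀ·root⇒⊓≡⊓ᵀ p₀ y-root))
      y⊔v⊓∁y≡v : y ⊔ (v ⊓ ∁ y) ≡ v
      y⊔v⊓∁y≡v = trans (⊔-distribˡ-⊓ y v (∁ y))
                   (trans (cong₂ _⊓_ y⊑v (⊔-complementʳ y)) (⊓-identityʳ v))

    y⊑roots·⊤ : y ⊑ roots · ⊤
    y⊑roots·⊤ = begin
      y                          ≡⟨ vector-test·⊤ y⊤≡y ⟨
      (y ⊓ 𝟏) · ⊤                ≡⟨ cong ((y ⊓ 𝟏) ·_) (total⇒·⊤≡⊤ (proj₂ mapping-p₀)) ⟨
      (y ⊓ 𝟏) · (p₀ · ⊤)         ≡⟨ trans (sym (·-assoc (y ⊓ 𝟏) p₀ ⊤)) (cong (_· ⊤) (sym (vector-⊓≡test· p₀ y⊤≡y))) ⟩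
      (y ⊓ p₀) · ⊤               ≤⟨ ·-monoˡ ⊤ (⊓-greatest x⊓y⊑y y⊓p₀⊑𝟏) ⟩
      roots · ⊤                  ∎
      where
      y⊓p₀⊑𝟏 : y ⊓ p₀ ⊑ 𝟏
      y⊓p₀⊑𝟏 = begin
        y ⊓ p₀                   ≡⟨ ᵀ·root⇒⊓≡⊓ᵀ p₀ y-root ⟩
        y ⊓ y ᵀ                  ≡⟨ vector-⊓≡test· (y ᵀ) y⊤≡y ⟩
        (y ⊓ 𝟏) · y ᵀ            ≤⟨ ·-monoˡ (y ᵀ) x⊓y⊑x ⟩
        y · y ᵀ                  ≤⟨ y-inj ⟩
        𝟏                        ∎

    y⊑roots·y : y ⊑ roots · y
    y⊑roots·y = ⊑-reflexive (trans (sym (⊑⇒⊓≡ y⊑roots·⊤)) (trans (⊓-comm y (roots · ⊤)) (test·⊤-⊓ y roots⊑𝟏)))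

    v⊑p₀*·y : v ⊑ p₀ * · y
    v⊑p₀*·y = begin
      (p₀ ᵀ) * · x                       ≤⟨ ·-monoʳ ((p₀ ᵀ) *) x⊑p₀*·y ⟩
      (p₀ ᵀ) * · (p₀ * · y)              ≡⟨ ·-assoc ((p₀ ᵀ) *) (p₀ *) y ⟨
      (p₀ ᵀ) * · p₀ * · y                ≤⟨ ·-monoˡ y (univalent⇒ᵀ*·*⊑ univalent-p) ⟩
      (p₀ * ⊔ (p₀ ᵀ) *) · y              ≡⟨ ·-distribʳ-⊔ y (p₀ *) ((p₀ ᵀ) *) ⟩
      p₀ * · y ⊔ ancestors y             ≡⟨ cong (p₀ * · y ⊔_) ancestors-y ⟩
      p₀ * · y ⊔ y                       ≤⟨ ⊔-least ⊑-refl z⊑x*·z ⟩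
      p₀ * · y                           ∎
      where
      x⊑p₀*·y : x ⊑ p₀ * · y
      x⊑p₀*·y = subst (λ m → x ⊑ m · y) (trans (*-ᵀ (p₀ ᵀ)) (cong _* (ᵀ-inv p₀)))
                  (injective-surjective-swap ((p₀ ᵀ) *) (proj₁ x-point) (proj₁ (proj₂ y-point)) y⊑v)

    P⊑p₀⁺ : P ⊑ p₀ ⁺
    P⊑p₀⁺ = ⊑-trans (update⊑⊔ v (p₀ · p₀) p₀) (⊔-least (·-monoʳ p₀ x⊑x*) x⊑x⁺)

    P*⊑p₀* : P * ⊑ p₀ *
    P*⊑p₀* = star-least-closure 𝟏⊑x* x*·x*⊑x* (⊑-trans P⊑p₀⁺ x⁺⊑x*)

    Pᵀ*⊑p₀ᵀ* : (P ᵀ) * ⊑ (p₀ ᵀ) *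
    Pᵀ*⊑p₀ᵀ* = subst₂ _⊑_ (*-ᵀ P) (*-ᵀ p₀) (ᵀ-mono P*⊑p₀*)

    mapping-P : mapping P
    mapping-P = update-mapping vector-v (mapping-· mapping-p₀ mapping-p₀) mapping-p₀

    P⊓𝟏≡roots : P ⊓ 𝟏 ≡ roots
    P⊓𝟏≡roots = begin-equality
      P ⊓ 𝟏                                ≡⟨ update-⊓ v (p₀ · p₀) p₀ 𝟏 ⟩
      update v (p₀ · p₀ ⊓ 𝟏) roots         ≡⟨ cong (λ m → update v m roots) p₀p₀⊓𝟏≡roots ⟩
      update v roots roots                 ≡⟨ update-idem v roots ⟩
      roots                                ∎
      where
      p₀p₀⊓𝟏≡roots : p₀ · p₀ ⊓ 𝟏 ≡ roots
      p₀p₀⊓𝟏≡roots = ⊑-antisym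
        (⊑-trans (⊓-mono (·-monoʳ p₀ x⊑x*) ⊑-refl) p⁺⊓𝟏⊑roots)
        (⊓-greatest (subst (_⊑ p₀ · p₀) (test-idem roots⊑𝟏) (·-mono x⊓y⊑x x⊓y⊑x)) roots⊑𝟏)

    -- Induction down the path: every node of v lies in P* y together with its p₀-parent, since
    -- within v the relation P sends a node to its grandparent and the root y is its own parent.
    v⊑P*·y : v ⊑ P * · y
    v⊑P*·y = begin
      v                            ≡⟨ ⊓-idem v ⟨
      v ⊓ v                        ≤⟨ ⊓-mono v⊑p₀*·y ⊑-refl ⟩
      p₀ * · y ⊓ v                 ≤⟨ ⊑∁⊔⇒⊓⊑ (star-leastˡ (⊑-trans (⊓-greatest z⊑x*·z y⊑p₀D) y⊑x⊔y) p₀-closed) ⟩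
      D ⊓ p₀ · D                   ≤⟨ x⊓y⊑x ⟩
      D                            ∎
      where
      D : S
      D = P * · y
      y⊑p₀D : y ⊑ p₀ · D
      y⊑p₀D = ⊑-trans y⊑roots·y (·-mono x⊓y⊑x z⊑x*·z)
      p₀p₀D⊑ : p₀ · (p₀ · D) ⊑ ∁ v ⊔ D
      p₀p₀D⊑ = ⊓⊑⇒⊑∁⊔ (begin
        p₀ · (p₀ · D) ⊓ v          ≡⟨ trans (⊓-comm _ v) (cong (v ⊓_) (sym (·-assoc p₀ p₀ D))) ⟩
        v ⊓ p₀ · p₀ · D            ≡⟨ vector-⊓-· (p₀ · p₀) D vector-v ⟩
        (v ⊓ p₀ · p₀) · D          ≤⟨ ·-monoˡ D x⊑x⊔y ⟩
        P · (P * · y)              ≡⟨ ·-assoc P (P *) y ⟨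
        P · P * · y                ≤⟨ ·-monoˡ y x·x*⊑x* ⟩
        D                          ∎)
      p₀-closed : p₀ · (∁ v ⊔ (D ⊓ p₀ · D)) ⊑ ∁ v ⊔ (D ⊓ p₀ · D)
      p₀-closed = begin
        p₀ · (∁ v ⊔ (D ⊓ p₀ · D))
          ≡⟨ ·-distribˡ-⊔ p₀ (∁ v) (D ⊓ p₀ · D) ⟩
        p₀ · ∁ v ⊔ p₀ · (D ⊓ p₀ · D)
          ≤⟨ ⊔-mono (ᵀ·⊑⇒·∁⊑∁ (parent-ancestors⊑ x)) (⊓-greatest (·-monoʳ p₀ x⊓y⊑x) (·-monoʳ p₀ x⊓y⊑y)) ⟩
        ∁ v ⊔ (p₀ · D ⊓ p₀ · (p₀ · D))
          ≤⟨ ⊔-mono ⊑-refl (⊓-mono ⊑-refl p₀p₀D⊑) ⟩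
        ∁ v ⊔ (p₀ · D ⊓ (∁ v ⊔ D))
          ≡⟨ cong (∁ v ⊔_) (⊓-distribˡ-⊔ (p₀ · D) (∁ v) D) ⟩
        ∁ v ⊔ ((p₀ · D ⊓ ∁ v) ⊔ (p₀ · D ⊓ D))
          ≤⟨ ⊔-least x⊑x⊔y (⊔-mono x⊓y⊑y (⊑-reflexive (⊓-comm (p₀ · D) D))) ⟩
        ∁ v ⊔ (D ⊓ p₀ · D)
          ∎

    reach : y ≡ (P ᵀ) * · x ⊓ (P ⊓ 𝟏) · ⊤
    reach = ⊑-antisym (⊓-greatest y⊑ (subst (λ m → y ⊑ m · ⊤) (sym P⊓𝟏≡roots) y⊑roots·⊤)) (begin
      (P ᵀ) * · x ⊓ (P ⊓ 𝟏) · ⊤        ≡⟨ cong (λ m → (P ᵀ) * · x ⊓ m · ⊤) P⊓𝟏≡roots ⟩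
      (P ᵀ) * · x ⊓ roots · ⊤          ≤⟨ ⊓-mono (·-monoˡ x Pᵀ*⊑p₀ᵀ*) ⊑-refl ⟩
      v ⊓ roots · ⊤                    ≡⟨ trans (⊓-comm v (roots · ⊤)) (test·⊤-⊓ v roots⊑𝟏) ⟩
      roots · v                        ≤⟨ ·-monoʳ roots v⊑p₀*·y ⟩
      roots · (p₀ * · y)               ≡⟨ ·-assoc roots (p₀ *) y ⟨
      roots · p₀ * · y                 ≤⟨ ·-monoˡ y (⊑-trans roots·p*⊑roots roots⊑𝟏) ⟩
      𝟏 · y                            ≡⟨ ·-identityˡ y ⟩
      y                                ∎)
      where
      y⊑ : y ⊑ (P ᵀ) * · x
      y⊑ = subst (λ m → y ⊑ m · x) (*-ᵀ P)
             (injective-surjective-swap (P *) y-inj (proj₁ (proj₂ x-point)) (⊑-trans ⊑ancestors v⊑P*·y))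

    closure : P * · (P ᵀ) * ≡ p₀ * · (p₀ ᵀ) *
    closure = ⊑-antisym (·-mono P*⊑p₀* Pᵀ*⊑p₀ᵀ*) (begin
      p₀ * · (p₀ ᵀ) *          ≤⟨ ·-mono (closed p₀⊑E) (closed p₀ᵀ⊑E) ⟩
      E · E                    ≤⟨ E·E⊑E ⟩
      E                        ∎)
      where
      E : S
      E = P * · (P ᵀ) *
      E·E⊑E : E · E ⊑ E
      E·E⊑E = univalent⇒*·ᵀ*-transitive (proj₁ mapping-P)
      P*⊑E : P * ⊑ E
      P*⊑E = subst (_⊑ E) (·-identityʳ (P *)) (·-monoʳ (P *) 𝟏⊑x*)
      closed : ∀ {z} → z ⊑ E → z * ⊑ E
      closed = star-least-closure (⊑-trans 𝟏⊑x* P*⊑E) E·E⊑E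
      vvᵀ⊑E : v · v ᵀ ⊑ E
      vvᵀ⊑E = subst (v · v ᵀ ⊑_) (cong (P * ·_) (*-ᵀ P)) (⊑·injective⇒·ᵀ⊑ y-inj v⊑P*·y)
      p₀⊑E : p₀ ⊑ E
      p₀⊑E = begin
        p₀                             ≡⟨ update-idem v p₀ ⟨
        (v ⊓ p₀) ⊔ (∁ v ⊓ p₀)          ≤⟨ ⊔-mono (vector-⊓⊑·ᵀ vector-v (parent-ancestors⊑ x)) y⊑x⊔y ⟩
        v · v ᵀ ⊔ P                    ≤⟨ ⊔-least vvᵀ⊑E (⊑-trans x⊑x* P*⊑E) ⟩
        E                              ∎
      p₀ᵀ⊑E : p₀ ᵀ ⊑ E
      p₀ᵀ⊑E = subst (p₀ ᵀ ⊑_) (ᵀ-*·ᵀ* P) (ᵀ-mono p₀⊑E)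

    post : ∀ t → Post p₀ x ⟨ P , t , y ⟩
    post _ = (mapping-P , ⊑p⁺⇒acyclic-⊓∁𝟏 P⊑p₀⁺) , y-point , reach , closure , P⊓𝟏≡roots , refl

  invariant-exit : ∀ {p t y} → Invariant ⟨ p , t , y ⟩ → y ≡ p ᵀ · y → Post p₀ x ⟨ p , t , y ⟩
  invariant-exit {p} {t} {y} (y-point , y⊑v , p≡) y≡pᵀy =
    subst (λ m → Post p₀ x ⟨ m , t , y ⟩) (sym (trans p≡ halve-halved≡P)) (post t)
    where
    y-root : p₀ ᵀ · y ≡ y
    y-root = sym (trans y≡pᵀy (trans (cong (λ m → m ᵀ · y) p≡) (halve-ᵀ· (proj₂ (proj₂ y-point)) ⊑ancestors)))
    open Root y-point y⊑v y-root

  loop-correct : ∀ {s s′} → Loop s s′ → Invariant s → Post p₀ x s′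
  loop-correct {s} (loop-exit exit) I = invariant-exit {t = State.t s} I exit
  loop-correct {s} (loop-step continue L) I = loop-correct L (proj₁ (invariant-step {t = State.t s} I continue))

  loop-terminates : ∀ s → Invariant s → Acc (flip _⊏_) (halved (State.y s)) → Σ State (Loop s)
  loop-terminates s I (acc rs) with State.y s ≟ (State.p s ᵀ · State.y s)
  ... | yes exit = s , loop-exit exit
  ... | no continue = map₂ (loop-step continue) (loop-terminates (body s) (proj₁ step) (rs (proj₂ step)))
    where
    step : Invariant (body s) × halved (State.y s) ⊏ halved (State.y (body s))
    step = invariant-step {t = State.t s} I continue

mainTheorem18 : (K : KleeneRelationAlgebra) →
    let open KleeneRelationAlgebra K in
    Finite → Tarski →
    ∀ (p₀ x t₀ y₀ : S) → forest p₀ → point x →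
    (Σ State λ s′ → Exec x ⟨ p₀ , t₀ , y₀ ⟩ s′)
    × (∀ s′ → Exec x ⟨ p₀ , t₀ , y₀ ⟩ s′ → Post p₀ x s′)
mainTheorem18 K (_ , S↔Fin) tarski p₀ x t₀ _ p₀-forest x-point =
  loop-terminates _ (invariant-init t₀) (finite⇒noetherian S↔Fin ⊑-isPartialOrder (halved x)) ,
  λ _ exec → loop-correct exec (invariant-init t₀)
  where
  open RelationAlgebra K using (⊑-isPartialOrder)
  open PathHalving K tarski (finite⇒≟ S↔Fin) p₀-forest x-point
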